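{- Let $\varepsilon>0$, let $G=(V,E)$ be a bipartite graph, and let $\beta > 8\varepsilon^{ -2}$. Let $H$ be a weighted edge-degree constrained subgraph of $G$ with parameters $\beta$ and $\beta^- = \beta - 1$. Then $\mu(H) \ge (1-\varepsilon)\mu(G)$.
   Context: $\mu(\cdot)$ denotes the maximum matching size; for weighted $H$, $\mu(H)$ is the maximum size of a matching using edges of $H$ (weights ignored). A weighted edge-degree constrained subgraph with parameters $(G,\beta,\beta^-)$ is a set $H\subseteq E$ with a positive integer weight on each edge of $H$, where $d_H(v)$ denotes the sum of the weights of edges of $H$ incident to $v$ (0 if none), such that (P1) every edge $(u,v)\in H$ satisfies $d_H(u)+d_H(v)\le\beta$, and (P2) every edge $(u,v)\in E$ (in $H$ or not) satisfies $d_H(u)+d_H(v)\ge\beta^-$. -}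

module Defs where

open import Data.Nat using (ℕ; suc)
open import Data.Fin using (Fin)
open import Data.Bool using (Bool)
open import Data.List using (List; []; _∷_; length; map; allFin; concatMap)
open import Data.Nat.ListAction using (sum)
open import Data.List.Relation.Unary.All using (All)
open import Data.List.Relation.Unary.Unique.Propositional using (Unique)
open import Data.Product using (_×_; _,_; proj₁; proj₂)
open import Data.Integer using (+_)
open import Data.Rational using (ℚ; _/_; _≤_; _+_; _-_; 1ℚ)
open import Relation.Binary.PropositionalEquality using (_≡_; _≢_)
open import Relation.Nullary using (¬_)

toℚ : ℕ → ℚ
toℚ n = + n / 1

record Graph : Set₁ where
  field
    n     : ℕ
    Adj   : Fin n → Fin n → Set
    sym   : ∀ {u v} → Adj u v → Adj v u
    irrefl : ∀ {u} → ¬ Adj u u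
open Graph public

Bipartite : Graph → Set
Bipartite G = Σcol
  where
  open import Data.Product using (Σ)
  Σcol = Σ (Fin (n G) → Bool) λ c → ∀ {u v} → Adj G u v → c u ≢ c v

endpoints : ∀ {m} → List (Fin m × Fin m) → List (Fin m)
endpoints = concatMap (λ e → proj₁ e ∷ proj₂ e ∷ [])

IsMatching : ∀ {m} → (Fin m → Fin m → Set) → List (Fin m × Fin m) → Set
IsMatching R M = All (λ e → R (proj₁ e) (proj₂ e)) M × Unique (endpoints M)

IsMaxMatchingSize : ∀ {m} → (Fin m → Fin m → Set) → ℕ → Set
IsMaxMatchingSize {m} R k =
  (Data.Product.Σ (List (Fin m × Fin m)) λ M → IsMatching R M × length M ≡ k)
  × (∀ M → IsMatching R M → length M Data.Nat.≤ k)
  where import Data.Product; import Data.Nat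

-- A weighted subgraph H of G: symmetric weight function, weight 0 means
-- "edge not in H"; edges of H (positive weight) must be edges of G.
record WeightedSubgraph (G : Graph) : Set where
  field
    w      : Fin (n G) → Fin (n G) → ℕ
    w-sym  : ∀ u v → w u v ≡ w v u
    w-sub  : ∀ u v → w u v ≢ 0 → Adj G u v
open WeightedSubgraph public

InH : ∀ {G} → WeightedSubgraph G → Fin (n G) → Fin (n G) → Set
InH H u v = w H u v ≢ 0

degH : ∀ {G} → WeightedSubgraph G → Fin (n G) → ℕ
degH {G} H v = sum (map (w H v) (allFin (n G)))

IsWeightedEDCS : (G : Graph) → WeightedSubgraph G → ℚ → ℚ → Set
IsWeightedEDCS G H β β⁻ =
  (∀ u v → InH H u v → toℚ (degH H u) + toℚ (degH H v) ≤ β)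
  × (∀ u v → Adj G u v → β⁻ ≤ toℚ (degH H u) + toℚ (degH H v))

module Submission where

-- Let U = ⌊β⌋, so that d a + d b ≤ U on every edge of H and d a + d b ≥ U - 1 on every edge of G.
-- By König's theorem (in Rizzi's inductive form) the support of H has a vertex cover C
-- with |C| ≤ μ(H).  Give every vertex a dual weight y depending only on its side and its degree,
-- capped at m, such that y a + y b ≥ m on edges of G, y a + y b ≤ m + 1 on edges of H, and y v > 0
-- only if d v ≥ s.  Then m μ(G) ≤ Σ y, and charging the weight of each vertex outside C to its
-- H-neighbours in C gives s Σ y ≤ |C| (U - s)(m + 1).  With m the integer nearest to the maximiser
-- of a quadratic (m ≈ √(U/2)) and s = ⌊(U + 1 - m)/2⌋ one gets s m ≥ (1 - ε)(U - s)(m + 1) as soon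
-- as (U + 1) ε² > 8.

module Sums where

  open import Data.Nat hiding (_≟_)
  open import Data.Nat.Properties hiding (_≟_)
  open import Algebra.Properties.CommutativeSemigroup +-commutativeSemigroup using (x∙yz≈y∙xz)
  open import Data.Fin using (Fin; zero; suc; _≟_)
  open import Data.Bool using (Bool; true; false; if_then_else_)
  open import Data.List using (List; []; _∷_; map; allFin; tabulate)
  open import Data.List.Properties using (map-tabulate)
  import Data.Nat.ListAction as List
  open import Data.List.Relation.Unary.All using (All; []; _∷_)
  open import Data.List.Relation.Unary.Unique.Propositional using (Unique; []; _∷_)
  open import Data.Product using (Σ; ∃; _×_; _,_)
  open import Function using (_∘_)
  open import Relation.Binary.PropositionalEquality
  open import Relation.Nullary using (yes; no; does)
  open import Relation.Nullary.Negation using (contradiction)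
  open import Algebra.Properties.Semiring.Sum +-*-semiring public
    using (sum; sum-cong-≗; ∑-distrib-+; ∑-comm; *-distribˡ-sum; *-distribʳ-sum; sum-replicate-zero)

  private variable
    n : ℕ
    f g : Fin n → ℕ

  𝟙 : Bool → ℕ
  𝟙 true = 1
  𝟙 false = 0

  𝟙≤1 : ∀ b → 𝟙 b ≤ 1
  𝟙≤1 true = ≤-refl
  𝟙≤1 false = z≤n

  𝟙-pos : ∀ {b} → 0 < 𝟙 b → b ≡ true
  𝟙-pos {true} _ = refl

  𝟙-mono : ∀ {x y} → (x ≡ true → y ≡ true) → 𝟙 x ≤ 𝟙 y
  𝟙-mono {false} _ = z≤n
  𝟙-mono {true} x⇒y rewrite x⇒y refl = ≤-refl

  isPos : ℕ → Bool
  isPos zero = false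
  isPos (suc _) = true

  isPos⇒≢0 : ∀ {k} → isPos k ≡ true → k ≢ 0
  isPos⇒≢0 {suc _} _ ()

  ≢0⇒isPos : ∀ {k} → k ≢ 0 → isPos k ≡ true
  ≢0⇒isPos {zero} k≢0 = contradiction refl k≢0
  ≢0⇒isPos {suc _} _ = refl

  sum-mono-≤ : (∀ i → f i ≤ g i) → sum f ≤ sum g
  sum-mono-≤ {zero} f≤g = z≤n
  sum-mono-≤ {suc n} f≤g = +-mono-≤ (f≤g zero) (sum-mono-≤ (f≤g ∘ suc))

  sum₂-+ : ∀ {m} (f g : Fin n → Fin m → ℕ) →
           sum (λ a → sum (λ b → f a b + g a b)) ≡ sum (λ a → sum (f a)) + sum (λ a → sum (g a))
  sum₂-+ f g = trans (sum-cong-≗ (λ a → ∑-distrib-+ (f a) (g a))) (∑-distrib-+ (λ a → sum (f a)) (λ a → sum (g a)))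

  sum-zero : sum {n} (λ _ → 0) ≡ 0
  sum-zero {n} = sum-replicate-zero n

  zeroAt : Fin n → (Fin n → ℕ) → Fin n → ℕ
  zeroAt x f i = if does (i ≟ x) then 0 else f i

  zeroAt-≢ : ∀ {x i} (f : Fin n → ℕ) → i ≢ x → zeroAt x f i ≡ f i
  zeroAt-≢ {x = x} {i} f i≢x with i ≟ x
  ... | yes i≡x = contradiction i≡x i≢x
  ... | no _ = refl

  zeroAt-pos : ∀ {x i} (f : Fin n → ℕ) → 0 < zeroAt x f i → i ≢ x × 0 < f i
  zeroAt-pos {x = x} {i} f pos with i ≟ x
  ... | no i≢x = i≢x , pos

  zeroAt≤ : ∀ x (f : Fin n → ℕ) i → zeroAt x f i ≤ f i
  zeroAt≤ x f i with i ≟ x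
  ... | yes _ = z≤n
  ... | no _ = ≤-refl

  zeroAt-≤1 : ∀ {x} {f : Fin n → ℕ} → (∀ i → f i ≤ 1) → ∀ i → zeroAt x f i ≤ 1
  zeroAt-≤1 {x = x} {f} f≤1 i = ≤-trans (zeroAt≤ x f i) (f≤1 i)

  sum-zeroAt : ∀ x (f : Fin n → ℕ) → sum f ≡ f x + sum (zeroAt x f)
  sum-zeroAt zero f = refl
  sum-zeroAt (suc x) f = begin
    f zero + sum (f ∘ suc)                         ≡⟨ cong (f zero +_) (sum-zeroAt x (f ∘ suc)) ⟩
    f zero + (f (suc x) + sum (zeroAt x (f ∘ suc))) ≡⟨ x∙yz≈y∙xz (f zero) (f (suc x)) _ ⟩
    f (suc x) + (f zero + sum (zeroAt x (f ∘ suc))) ≡⟨ cong (λ t → f (suc x) + (f zero + t)) (sum-cong-≗ shift) ⟩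
    f (suc x) + sum (zeroAt (suc x) f)             ∎
    where
    open ≡-Reasoning
    shift : ∀ i → zeroAt x (f ∘ suc) i ≡ zeroAt (suc x) f (suc i)
    shift i with i ≟ x
    ... | yes _ = refl
    ... | no _ = refl

  sum≡0⇒≡0 : ∀ (f : Fin n → ℕ) → sum f ≡ 0 → ∀ i → f i ≡ 0
  sum≡0⇒≡0 f ∑f≡0 i = m+n≡0⇒m≡0 (f i) (trans (sym (sum-zeroAt i f)) ∑f≡0)

  sum-pos⇒pos : ∀ (f : Fin n → ℕ) → 0 < sum f → ∃ λ i → 0 < f i
  sum-pos⇒pos {suc n} f ∑f>0 with f zero in eq
  ... | suc _ = zero , subst (0 <_) (sym eq) z<s
  ... | zero with sum-pos⇒pos (f ∘ suc) ∑f>0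
  ...   | i , fi>0 = suc i , fi>0

  sum-strict-mono : ∀ x → (∀ i → f i ≤ g i) → f x < g x → sum f < sum g
  sum-strict-mono {f = f} {g} x f≤g fx<gx = begin-strict
    sum f                   ≡⟨ sum-zeroAt x f ⟩
    f x + sum (zeroAt x f)  <⟨ +-monoˡ-< _ fx<gx ⟩
    g x + sum (zeroAt x f)  ≤⟨ +-monoʳ-≤ (g x) (sum-mono-≤ zeroAt-mono) ⟩
    g x + sum (zeroAt x g)  ≡⟨ sum-zeroAt x g ⟨
    sum g                   ∎
    where
    open ≤-Reasoning
    zeroAt-mono : ∀ i → zeroAt x f i ≤ zeroAt x g i
    zeroAt-mono i with i ≟ x
    ... | yes _ = z≤n
    ... | no _ = f≤g i

  support-point : ∀ k (f : Fin n → ℕ) → (∀ i → f i ≤ 1) → suc k ≤ sum f →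
         ∃ λ i → 0 < f i × k ≤ sum (zeroAt i f)
  support-point k f f≤1 k<∑f with sum-pos⇒pos f (≤-trans z<s k<∑f)
  ... | i , fi>0 = i , fi>0 , +-cancelˡ-≤ 1 k _ (begin
    suc k                   ≤⟨ k<∑f ⟩
    sum f                   ≡⟨ sum-zeroAt i f ⟩
    f i + sum (zeroAt i f)  ≤⟨ +-monoˡ-≤ _ (f≤1 i) ⟩
    1 + sum (zeroAt i f)    ∎)
    where open ≤-Reasoning

  sum-allFin : ∀ (f : Fin n → ℕ) → List.sum (map f (allFin n)) ≡ sum f
  sum-allFin {n} f = trans (cong List.sum (map-tabulate (λ i → i) f)) (sum-tabulate f)
    where
    sum-tabulate : ∀ {n} (f : Fin n → ℕ) → List.sum (tabulate f) ≡ sum f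
    sum-tabulate {zero} f = refl
    sum-tabulate {suc n} f = cong (f zero +_) (sum-tabulate (f ∘ suc))

  sum-distinct≤sum : ∀ (xs : List (Fin n)) → Unique xs → (f : Fin n → ℕ) → List.sum (map f xs) ≤ sum f
  sum-distinct≤sum [] [] f = z≤n
  sum-distinct≤sum (x ∷ xs) (x∉xs ∷ uxs) f = begin
    f x + List.sum (map f xs)            ≡⟨ cong (f x +_) (sum-map-zeroAt xs x∉xs) ⟩
    f x + List.sum (map (zeroAt x f) xs) ≤⟨ +-monoʳ-≤ (f x) (sum-distinct≤sum xs uxs (zeroAt x f)) ⟩
    f x + sum (zeroAt x f)               ≡⟨ sum-zeroAt x f ⟨
    sum f                                ∎
    where
    open ≤-Reasoning
    sum-map-zeroAt : ∀ ys → All (x ≢_) ys → List.sum (map f ys) ≡ List.sum (map (zeroAt x f) ys)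
    sum-map-zeroAt [] [] = refl
    sum-map-zeroAt (y ∷ ys) (x≢y ∷ x∉ys) =
      cong₂ _+_ (sym (zeroAt-≢ f (x≢y ∘ sym))) (sum-map-zeroAt ys x∉ys)

  δ : Fin n → Fin n → ℕ
  δ x a = 𝟙 (does (a ≟ x))

  δ-self : ∀ (x : Fin n) → δ x x ≡ 1
  δ-self x with x ≟ x
  ... | yes _ = refl
  ... | no x≢x = contradiction refl x≢x

  sum-δ : ∀ (x : Fin n) → sum (δ x) ≡ 1
  sum-δ {n} x = begin
    sum (δ x)                   ≡⟨ sum-zeroAt x (δ x) ⟩
    δ x x + sum (zeroAt x (δ x)) ≡⟨ cong₂ _+_ (δ-self x) (trans (sum-cong-≗ vanish) (sum-zero {n})) ⟩
    1                           ∎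
    where
    open ≡-Reasoning
    vanish : ∀ a → zeroAt x (δ x) a ≡ 0
    vanish a with a ≟ x
    ... | yes _ = refl
    ... | no _ = refl

  sum-δ*δ : ∀ (x y : Fin n) → sum (λ a → sum (λ b → δ x a * δ y b)) ≡ 1
  sum-δ*δ x y = begin
    sum (λ a → sum (λ b → δ x a * δ y b)) ≡⟨ sum-cong-≗ (λ a → *-distribˡ-sum (δ x a) (δ y)) ⟨
    sum (λ a → δ x a * sum (δ y))         ≡⟨ sum-cong-≗ (λ a → cong (δ x a *_) (sum-δ y)) ⟩
    sum (λ a → δ x a * 1)                 ≡⟨ sum-cong-≗ (λ a → *-identityʳ (δ x a)) ⟩
    sum (δ x)                             ≡⟨ sum-δ x ⟩
    1                                     ∎
    where open ≡-Reasoning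

  three-points : ∀ (f : Fin n → ℕ) → (∀ i → f i ≤ 1) → 3 ≤ sum f →
    Σ (Fin n × Fin n × Fin n) λ (x , y , z) → 0 < f x × 0 < f y × 0 < f z × y ≢ x × z ≢ x × y ≢ z
  three-points f f≤1 3≤∑f
    with support-point 2 f f≤1 3≤∑f
  ... | x , fx>0 , 2≤∑f₁
    with support-point 1 (zeroAt x f) (zeroAt-≤1 f≤1) 2≤∑f₁
  ... | y , f₁y>0 , 1≤∑f₂
    with support-point 0 (zeroAt y (zeroAt x f)) (zeroAt-≤1 (zeroAt-≤1 f≤1)) 1≤∑f₂
  ... | z , f₂z>0 , _
    with zeroAt-pos f f₁y>0 | zeroAt-pos (zeroAt x f) f₂z>0
  ... | y≢x , fy>0 | z≢y , f₁z>0
    with zeroAt-pos f f₁z>0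
  ... | z≢x , fz>0 = (x , y , z) , fx>0 , fy>0 , fz>0 , y≢x , z≢x , z≢y ∘ sym

  sum≡1⇒unique : ∀ (f : Fin n → ℕ) → (∀ i → f i ≤ 1) → sum f ≡ 1 →
                 ∀ {x y} → 0 < f x → 0 < f y → y ≡ x
  sum≡1⇒unique f f≤1 ∑f≡1 {x} {y} fx>0 fy>0 with y ≟ x
  ... | yes y≡x = y≡x
  ... | no y≢x = contradiction (trans (sym (zeroAt-≢ f y≢x)) (sum≡0⇒≡0 (zeroAt x f) rest≡0 y)) (>⇒≢ fy>0)
    where
    rest≡0 : sum (zeroAt x f) ≡ 0
    rest≡0 = +-cancelˡ-≡ 1 _ _ (begin
      1 + sum (zeroAt x f)   ≡⟨ cong (_+ sum (zeroAt x f)) (≤-antisym (f≤1 x) fx>0) ⟨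
      f x + sum (zeroAt x f) ≡⟨ sum-zeroAt x f ⟨
      sum f                  ≡⟨ ∑f≡1 ⟩
      1                      ∎)
      where open ≡-Reasoning

module Matchings where

  open import Data.Nat hiding (_≟_)
  open import Data.Nat.Properties hiding (_≟_)
  import Data.Nat.ListAction as List
  open import Data.Bool using (Bool; true)
  open import Data.Fin using (Fin; _≟_)
  open import Data.List using (List; []; _∷_; map; length)
  open import Data.List.Membership.Propositional using (_∈_)
  open import Data.List.Relation.Unary.All as All using (All; []; _∷_)
  open import Data.List.Relation.Unary.Any using (Any; here; there; any?)
  open import Data.List.Relation.Unary.Unique.Propositional using (Unique; _∷_)
  open import Data.Product using (_×_; _,_; proj₁; proj₂)
  open import Data.Product.Properties using (≡-dec)
  open import Data.Sum using (_⊎_; inj₁; inj₂)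
  open import Function using (_∘_)
  open import Relation.Binary.PropositionalEquality
  open import Relation.Nullary using (Dec)
  open import Relation.Nullary.Decidable using (_⊎-dec_)
  open import Relation.Nullary.Negation using (contradiction)
  open import Defs using (endpoints; IsMatching)
  open Sums

  private variable
    n : ℕ

  Subset : ℕ → Set
  Subset n = Fin n → Bool

  size : Subset n → ℕ
  size C = sum (𝟙 ∘ C)

  Edge : ℕ → Set
  Edge n = Fin n × Fin n

  IsMatching-mono : ∀ {R S : Fin n → Fin n → Set} → (∀ {a b} → R a b → S a b) →
                    ∀ {M} → IsMatching R M → IsMatching S M
  IsMatching-mono R⊆S (M⊆R , unique) = All.map R⊆S M⊆R , unique

  matching-size-bound : ∀ (M : List (Edge n)) → Unique (endpoints M) → ∀ m (y : Fin n → ℕ) →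
                        All (λ e → m ≤ y (proj₁ e) + y (proj₂ e)) M → m * length M ≤ sum y
  matching-size-bound M unique m y covered =
    ≤-trans (bound M covered) (sum-distinct≤sum (endpoints M) unique y)
    where
    bound : ∀ M → All (λ e → m ≤ y (proj₁ e) + y (proj₂ e)) M →
            m * length M ≤ List.sum (map y (endpoints M))
    bound [] [] = ≤-reflexive (*-zeroʳ m)
    bound ((a , b) ∷ M) (m≤ya+yb ∷ covered) = begin
      m * suc (length M)                             ≡⟨ *-suc m (length M) ⟩
      m + m * length M                               ≤⟨ +-mono-≤ m≤ya+yb (bound M covered) ⟩
      y a + y b + List.sum (map y (endpoints M))     ≡⟨ +-assoc (y a) (y b) _ ⟩
      y a + (y b + List.sum (map y (endpoints M)))   ∎
      where open ≤-Reasoning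

  _—_∈_ : Fin n → Fin n → List (Edge n) → Set
  u — a ∈ M = Any (λ e → e ≡ (u , a) ⊎ e ≡ (a , u)) M

  —∈? : ∀ (u a : Fin n) M → Dec (u — a ∈ M)
  —∈? u a = any? (λ e → ≡-dec _≟_ _≟_ e (u , a) ⊎-dec ≡-dec _≟_ _≟_ e (a , u))

  —∈⇒∈endpoints : ∀ {u a : Fin n} {M} → u — a ∈ M → u ∈ endpoints M
  —∈⇒∈endpoints (here (inj₁ refl)) = here refl
  —∈⇒∈endpoints (here (inj₂ refl)) = there (here refl)
  —∈⇒∈endpoints {M = (x , y) ∷ M} (there p) = there (there (—∈⇒∈endpoints p))

  private
    head-fresh : ∀ {x y u a : Fin n} {zs} → (x , y) ≡ (u , a) ⊎ (x , y) ≡ (a , u) →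
                 All (x ≢_) zs → All (y ≢_) zs → All (u ≢_) zs
    head-fresh (inj₁ refl) x∉ _ = x∉
    head-fresh (inj₂ refl) _ y∉ = y∉

  partner-unique : ∀ {u a b : Fin n} M → Unique (endpoints M) → u — a ∈ M → u — b ∈ M → a ≡ b
  partner-unique _ _ (here (inj₁ refl)) (here (inj₁ refl)) = refl
  partner-unique _ ((x≢y ∷ _) ∷ _) (here (inj₁ refl)) (here (inj₂ refl)) = contradiction refl x≢y
  partner-unique _ ((x≢y ∷ _) ∷ _) (here (inj₂ refl)) (here (inj₁ refl)) = contradiction refl x≢y
  partner-unique _ _ (here (inj₂ refl)) (here (inj₂ refl)) = refl
  partner-unique (_ ∷ M) (_ ∷ _ ∷ unique) (there p) (there q) = partner-unique M unique p q
  partner-unique (_ ∷ M) ((_ ∷ x∉) ∷ y∉ ∷ _) (here p) (there q) =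
    contradiction refl (All.lookup (head-fresh p x∉ y∉) (—∈⇒∈endpoints q))
  partner-unique (_ ∷ M) ((_ ∷ x∉) ∷ y∉ ∷ _) (there p) (here q) =
    contradiction refl (All.lookup (head-fresh q x∉ y∉) (—∈⇒∈endpoints p))

  All-endpoints : ∀ {P : Fin n → Set} {R : Fin n → Fin n → Set} → (∀ {a b} → R a b → P a × P b) →
                  ∀ {M} → All (λ e → R (proj₁ e) (proj₂ e)) M → All P (endpoints M)
  All-endpoints both [] = []
  All-endpoints both (r ∷ rs) = proj₁ (both r) ∷ proj₂ (both r) ∷ All-endpoints both rs

  matching<cover : ∀ {M : List (Edge n)} {C : Subset n} {v} → Unique (endpoints M) →
                   All (λ e → (C (proj₁ e) ≡ true ⊎ C (proj₂ e) ≡ true) × proj₁ e ≢ v × proj₂ e ≢ v) M →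
                   C v ≡ true → length M < size C
  matching<cover {M = M} {C} {v} unique covered Cv = begin-strict
    length M                       ≡⟨ *-identityˡ (length M) ⟨
    1 * length M                   ≤⟨ matching-size-bound M unique 1 y (All.map hit covered) ⟩
    sum y                          <⟨ n<1+n (sum y) ⟩
    1 + sum y                      ≡⟨ cong (λ b → 𝟙 b + sum y) Cv ⟨
    𝟙 (C v) + sum y                ≡⟨ sum-zeroAt v (𝟙 ∘ C) ⟨
    size C                         ∎
    where
    open ≤-Reasoning
    y : Fin _ → ℕ
    y = zeroAt v (𝟙 ∘ C)
    y≡1 : ∀ {a} → a ≢ v → C a ≡ true → y a ≡ 1
    y≡1 a≢v Ca = trans (zeroAt-≢ (𝟙 ∘ C) a≢v) (cong 𝟙 Ca)
    hit : ∀ {e} → (C (proj₁ e) ≡ true ⊎ C (proj₂ e) ≡ true) × proj₁ e ≢ v × proj₂ e ≢ v →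
          1 ≤ y (proj₁ e) + y (proj₂ e)
    hit (inj₁ Ca , a≢v , _) = ≤-trans (≤-reflexive (sym (y≡1 a≢v Ca))) (m≤m+n _ _)
    hit (inj₂ Cb , _ , b≢v) = ≤-trans (≤-reflexive (sym (y≡1 b≢v Cb))) (m≤n+m _ _)

module Konig where

  open import Data.Nat hiding (_≟_)
  import Data.Nat as ℕ
  open import Data.Nat.Properties hiding (_≟_)
  open import Data.Fin using (Fin; _≟_)
  open import Data.Fin.Properties using (any?)
  open import Data.Bool using (Bool; true; false; if_then_else_; _∧_)
  import Data.Bool as B
  open import Data.Bool.Properties using (¬-not)
  open import Data.List using (List; []; _∷_; length)
  open import Data.List.Relation.Unary.All as All using (All; []; _∷_)
  open import Data.List.Relation.Unary.All.Properties using (¬Any⇒All¬)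
  open import Data.List.Relation.Unary.Unique.Propositional using ([]; _∷_)
  open import Data.Product using (Σ; ∃; _×_; _,_; proj₁; proj₂)
  open import Data.Sum using (_⊎_; inj₁; inj₂; swap; [_,_]; [_,_]′)
  open import Function using (_∘_)
  open import Relation.Binary.PropositionalEquality hiding ([_])
  open import Relation.Nullary using (Dec; yes; no; ¬_; does)
  open import Relation.Nullary.Decidable using (_×-dec_; _⊎-dec_)
  open import Relation.Nullary.Negation using (contradiction)
  open import Data.Nat.Solver using (module +-*-Solver)
  open import Defs using (endpoints; IsMatching)
  open Sums
  open Matchings

  private variable
    n : ℕ

  Rel : ℕ → Set
  Rel n = Fin n → Fin n → Bool

  deg : Rel n → Fin n → ℕ
  deg E a = sum (λ b → 𝟙 (E a b))

  -- Each edge is counted twice, once from each endpoint.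
  edgeCount : Rel n → ℕ
  edgeCount E = sum (deg E)

  Covers : Rel n → Subset n → Set
  Covers E C = ∀ a b → E a b ≡ true → C a ≡ true ⊎ C b ≡ true

  record IsBipartite (col : Fin n → Bool) (E : Rel n) : Set where
    field
      symmetric : ∀ {a b} → E a b ≡ true → E b a ≡ true
      bichromatic : ∀ {a b} → E a b ≡ true → col a ≢ col b

    irreflexive : ∀ {a} → ¬ E a a ≡ true
    irreflexive e = bichromatic e refl

  deg-mono : ∀ {E E′ : Rel n} {a} → (∀ {b} → E′ a b ≡ true → E a b ≡ true) → deg E′ a ≤ deg E a
  deg-mono {E = E} {E′} {a} E′⊆E = sum-mono-≤ {f = λ b → 𝟙 (E′ a b)} {λ b → 𝟙 (E a b)} (λ b → 𝟙-mono E′⊆E)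

  record KönigCertificate (E : Rel n) : Set where
    field
      matching : List (Edge n)
      isMatching : IsMatching (λ a b → E a b ≡ true) matching
      cover : Subset n
      covers : Covers E cover
      size≤length : size cover ≤ length matching

  remove : {P : Fin n → Fin n → Set} → (∀ a b → Dec (P a b)) → Rel n → Rel n
  remove P? E a b = if does (P? a b) then false else E a b

  module _ {P : Fin n → Fin n → Set} (P? : ∀ a b → Dec (P a b)) {E : Rel n} where

    remove⁻ : ∀ {a b} → remove P? E a b ≡ true → E a b ≡ true × ¬ P a b
    remove⁻ {a} {b} e with P? a b
    ... | no ¬p = e , ¬p

    remove⁺ : ∀ {a b} → E a b ≡ true → ¬ P a b → remove P? E a b ≡ true
    remove⁺ {a} {b} e ¬p with P? a b
    ... | yes p = contradiction p ¬p
    ... | no _ = e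

    remove-⊆ : ∀ {a b} → remove P? E a b ≡ true → E a b ≡ true
    remove-⊆ = proj₁ ∘ remove⁻

    remove-isBipartite : ∀ {col} → (∀ {a b} → P a b → P b a) →
                         IsBipartite col E → IsBipartite col (remove P? E)
    remove-isBipartite P-sym bip = record
      { symmetric = λ e → let (e′ , ¬p) = remove⁻ e in remove⁺ (symmetric e′) (¬p ∘ P-sym)
      ; bichromatic = bichromatic ∘ remove-⊆
      }
      where open IsBipartite bip

    edgeCount-remove : ∀ {u v} → E u v ≡ true → P u v → edgeCount (remove P? E) < edgeCount E
    edgeCount-remove {u} {v} euv p =
      sum-strict-mono {f = deg (remove P? E)} {deg E} u (λ a → deg-mono {E = E} {remove P? E} remove-⊆)
        (sum-strict-mono {f = λ b → 𝟙 (remove P? E u b)} {λ b → 𝟙 (E u b)} v (λ b → 𝟙-mono remove-⊆) removed)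
      where
      removed : 𝟙 (remove P? E u v) < 𝟙 (E u v)
      removed with P? u v
      ... | yes _ = subst (λ b → 0 < 𝟙 b) (sym euv) z<s
      ... | no ¬p = contradiction p ¬p

  Touches : Fin n → Fin n → Fin n → Set
  Touches v a b = a ≡ v ⊎ b ≡ v

  Joins : Fin n → Fin n → Fin n → Fin n → Set
  Joins u x a b = (a ≡ u × b ≡ x) ⊎ (a ≡ x × b ≡ u)

  touches? : ∀ (v a b : Fin n) → Dec (Touches v a b)
  touches? v a b = (a ≟ v) ⊎-dec (b ≟ v)

  joins? : ∀ (u x a b : Fin n) → Dec (Joins u x a b)
  joins? u x a b = ((a ≟ u) ×-dec (b ≟ x)) ⊎-dec ((a ≟ x) ×-dec (b ≟ u))

  deleteVertex : Fin n → Rel n → Rel n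
  deleteVertex v = remove (touches? v)

  deleteEdge : Fin n → Fin n → Rel n → Rel n
  deleteEdge u x = remove (joins? u x)

  Touches-sym : ∀ {v a b : Fin n} → Touches v a b → Touches v b a
  Touches-sym = swap

  Joins-sym : ∀ {u x a b : Fin n} → Joins u x a b → Joins u x b a
  Joins-sym (inj₁ (a≡u , b≡x)) = inj₂ (b≡x , a≡u)
  Joins-sym (inj₂ (a≡x , b≡u)) = inj₁ (b≡u , a≡x)

  insert : Fin n → Subset n → Subset n
  insert v C a = if does (a ≟ v) then true else C a

  size-insert : ∀ v (C : Subset n) → size (insert v C) ≤ suc (size C)
  size-insert v C = begin
    size (insert v C)                                 ≡⟨ sum-zeroAt v (𝟙 ∘ insert v C) ⟩
    𝟙 (insert v C v) + sum (zeroAt v (𝟙 ∘ insert v C)) ≤⟨ +-mono-≤ (𝟙≤1 _) (sum-mono-≤ rest) ⟩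
    1 + size C                                        ∎
    where
    open ≤-Reasoning
    rest : ∀ a → zeroAt v (𝟙 ∘ insert v C) a ≤ 𝟙 (C a)
    rest a with a ≟ v
    ... | yes _ = z≤n
    ... | no _ = ≤-refl

  module _ {E : Rel n} {C : Subset n} where

    covers-deleteVertex : ∀ {v} → Covers (deleteVertex v E) C → Covers E (insert v C)
    covers-deleteVertex {v} cov a b e with a ≟ v | b ≟ v
    ... | yes _ | _ = inj₁ refl
    ... | no _ | yes _ = inj₂ refl
    ... | no a≢v | no b≢v = cov a b (remove⁺ (touches? v) {E} e [ a≢v , b≢v ])

    covers-deleteEdge : ∀ {u x} → C u ≡ true → Covers (deleteEdge u x E) C → Covers E C
    covers-deleteEdge {u} {x} Cu cov a b e with joins? u x a b
    ... | yes (inj₁ (refl , _)) = inj₁ Cu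
    ... | yes (inj₂ (_ , refl)) = inj₂ Cu
    ... | no ¬j = cov a b (remove⁺ (joins? u x) {E} e ¬j)

  module _ {E : Rel n} where

    deg-pos : ∀ {a b} → E a b ≡ true → 1 ≤ deg E a
    deg-pos {a} {b} e = begin
      1                                            ≡⟨ cong 𝟙 e ⟨
      𝟙 (E a b)                                    ≤⟨ m≤m+n _ _ ⟩
      𝟙 (E a b) + sum (zeroAt b (λ c → 𝟙 (E a c))) ≡⟨ sum-zeroAt b (λ c → 𝟙 (E a c)) ⟨
      deg E a                                      ∎
      where open ≤-Reasoning

    neighbour : ∀ {u} → 1 ≤ deg E u → ∃ λ v → E u v ≡ true
    neighbour {u} 1≤deg with support-point 0 (λ b → 𝟙 (E u b)) (λ b → 𝟙≤1 (E u b)) 1≤deg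
    ... | v , pos , _ = v , 𝟙-pos pos

    three-neighbours : ∀ {u} → 3 ≤ deg E u →
      Σ (Fin n × Fin n × Fin n) λ (v , a₁ , a₂) →
        E u v ≡ true × E u a₁ ≡ true × E u a₂ ≡ true × a₁ ≢ v × a₂ ≢ v × a₁ ≢ a₂
    three-neighbours {u} 3≤deg with three-points (λ b → 𝟙 (E u b)) (λ b → 𝟙≤1 (E u b)) 3≤deg
    ... | vs , v , a₁ , a₂ , a₁≢v , a₂≢v , a₁≢a₂ =
      vs , 𝟙-pos v , 𝟙-pos a₁ , 𝟙-pos a₂ , a₁≢v , a₂≢v , a₁≢a₂

    deg≡1⇒unique-neighbour : ∀ {x y z} → deg E x ≡ 1 → E x y ≡ true → E x z ≡ true → z ≡ y
    deg≡1⇒unique-neighbour {x} d≡1 exy exz =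
      sum≡1⇒unique (λ b → 𝟙 (E x b)) (λ b → 𝟙≤1 (E x b)) d≡1
        (subst (λ b → 0 < 𝟙 b) (sym exy) z<s) (subst (λ b → 0 < 𝟙 b) (sym exz) z<s)

    deg∈0,2 : (∀ a → ¬ 3 ≤ deg E a) → (∀ a → deg E a ≢ 1) → ∀ a → deg E a ≡ 0 ⊎ deg E a ≡ 2
    deg∈0,2 ≱3 ≢1 a with deg E a in eq
    ... | 0 = inj₁ refl
    ... | 1 = contradiction eq (≢1 a)
    ... | 2 = inj₂ refl
    ... | suc (suc (suc _)) = contradiction (subst (3 ≤_) (sym eq) (s≤s (s≤s (s≤s z≤n)))) (≱3 a)

    edgeCount≤2*cover : ∀ {C : Subset n} → (∀ {a b} → E a b ≡ true → E b a ≡ true) → Covers E C →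
                        edgeCount E ≤ 2 * sum (λ a → 𝟙 (C a) * deg E a)
    edgeCount≤2*cover {C} sym-E cov = begin
      edgeCount E
        ≤⟨ sum-mono-≤ (λ a → sum-mono-≤ (split a)) ⟩
      sum (λ a → sum (λ b → 𝟙 (C a) * e a b + 𝟙 (C b) * e a b))
        ≡⟨ sum₂-+ (λ a b → 𝟙 (C a) * e a b) (λ a b → 𝟙 (C b) * e a b) ⟩
      sum (λ a → sum (λ b → 𝟙 (C a) * e a b)) + sum (λ a → sum (λ b → 𝟙 (C b) * e a b))
        ≡⟨ cong₂ _+_ (sym (sum-cong-≗ (λ a → *-distribˡ-sum (𝟙 (C a)) (e a))))
                     (trans (∑-comm (λ a b → 𝟙 (C b) * e a b)) (sum-cong-≗ transpose)) ⟩
      S + S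
        ≡⟨ cong (S +_) (+-identityʳ S) ⟨
      2 * S
        ∎
      where
      open ≤-Reasoning
      e : Fin n → Fin n → ℕ
      e a b = 𝟙 (E a b)
      S = sum (λ a → 𝟙 (C a) * deg E a)
      split : ∀ a b → e a b ≤ 𝟙 (C a) * e a b + 𝟙 (C b) * e a b
      split a b with E a b in eab
      ... | false = z≤n
      ... | true with cov a b eab
      ...   | inj₁ Ca rewrite Ca = m≤m+n 1 _
      ...   | inj₂ Cb rewrite Cb = m≤n+m 1 _
      e-sym : ∀ a b → e a b ≡ e b a
      e-sym a b with E a b in eab | E b a in eba
      ... | true | true = refl
      ... | false | false = refl
      ... | true | false = contradiction (trans (sym (sym-E eab)) eba) λ ()
      ... | false | true = contradiction (trans (sym (sym-E eba)) eab) λ ()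
      transpose : ∀ b → sum (λ a → 𝟙 (C b) * e a b) ≡ 𝟙 (C b) * deg E b
      transpose b = trans (sym (*-distribˡ-sum (𝟙 (C b)) (λ a → e a b)))
                          (cong (𝟙 (C b) *_) (sum-cong-≗ (λ a → e-sym a b)))

    edgeCount-deleteEdge : ∀ u v → edgeCount E ≤ edgeCount (deleteEdge u v E) + 2
    edgeCount-deleteEdge u v = begin
      edgeCount E
        ≤⟨ sum-mono-≤ (λ a → sum-mono-≤ (split a)) ⟩
      sum (λ a → sum (λ b → e′ a b + uv a b))
        ≡⟨ sum₂-+ e′ uv ⟩
      edgeCount E′ + sum (λ a → sum (uv a))
        ≡⟨ cong (edgeCount E′ +_) (sum₂-+ (λ a b → δ u a * δ v b) (λ a b → δ v a * δ u b)) ⟩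
      edgeCount E′ + (sum (λ a → sum (λ b → δ u a * δ v b)) + sum (λ a → sum (λ b → δ v a * δ u b)))
        ≡⟨ cong (edgeCount E′ +_) (cong₂ _+_ (sum-δ*δ u v) (sum-δ*δ v u)) ⟩
      edgeCount E′ + 2
        ∎
      where
      open ≤-Reasoning
      E′ = deleteEdge u v E
      e′ uv : Fin n → Fin n → ℕ
      e′ a b = 𝟙 (E′ a b)
      uv a b = δ u a * δ v b + δ v a * δ u b
      split : ∀ a b → 𝟙 (E a b) ≤ e′ a b + uv a b
      split a b with joins? u v a b
      ... | no ¬j = ≤-trans (𝟙-mono (λ e → remove⁺ (joins? u v) {E} e ¬j)) (m≤m+n _ _)
      ... | yes (inj₁ (refl , refl)) rewrite δ-self u | δ-self v =
        ≤-trans (𝟙≤1 (E a b)) (≤-trans (m≤m+n 1 _) (m≤n+m _ (e′ a b)))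
      ... | yes (inj₂ (refl , refl)) rewrite δ-self u | δ-self v =
        ≤-trans (𝟙≤1 (E a b)) (≤-trans (m≤n+m 1 _) (m≤n+m _ (e′ a b)))

  module _ {E : Rel n} {u a v : Fin n} where

    matching-deleteEdge : ∀ {M} → All (λ (x , z) → deleteVertex v E x z ≡ true) M → ¬ (u — a ∈ M) →
                          All (λ (x , z) → deleteEdge u a E x z ≡ true × x ≢ v × z ≢ v) M
    matching-deleteEdge M⊆E-v ua∉M = All.zipWith keep (M⊆E-v , ¬Any⇒All¬ _ ua∉M)
      where
      keep : ∀ {e} → deleteVertex v E (proj₁ e) (proj₂ e) ≡ true × ¬ (e ≡ (u , a) ⊎ e ≡ (a , u)) →
             deleteEdge u a E (proj₁ e) (proj₂ e) ≡ true × proj₁ e ≢ v × proj₂ e ≢ v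
      keep {x , z} (e , e≢ua) =
        let exz , ¬touch = remove⁻ (touches? v) {E} e
        in remove⁺ (joins? u a) {E} exz not-ua , ¬touch ∘ inj₁ , ¬touch ∘ inj₂
        where
        not-ua : ¬ Joins u a x z
        not-ua (inj₁ (refl , refl)) = e≢ua (inj₁ refl)
        not-ua (inj₂ (refl , refl)) = e≢ua (inj₂ refl)

  one-side-small : ∀ x y k → 2 * (x + y) ≤ 4 * k + 2 → x ≤ k ⊎ y ≤ k
  one-side-small x y k 2[x+y]≤4k+2 with x ≤? k | y ≤? k
  ... | yes x≤k | _ = inj₁ x≤k
  ... | no _ | yes y≤k = inj₂ y≤k
  ... | no x≰k | no y≰k = contradiction 2[x+y]≤4k+2 (<⇒≱ (begin-strict
    4 * k + 2              <⟨ +-monoʳ-< (4 * k) (s≤s (s≤s (s≤s z≤n))) ⟩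
    4 * k + 4              ≡⟨ solve 1 (λ k → con 4 :* k :+ con 4 := con 2 :* (con 1 :+ k :+ (con 1 :+ k))) refl k ⟩
    2 * (suc k + suc k)    ≤⟨ *-monoʳ-≤ 2 (+-mono-≤ (≰⇒> x≰k) (≰⇒> y≰k)) ⟩
    2 * (x + y)            ∎))
    where
    open ≤-Reasoning
    open +-*-Solver

  edgeless-certificate : ∀ {E : Rel n} → (∀ a → deg E a ≡ 0) → KönigCertificate E
  edgeless-certificate {n} {E} deg≡0 = record
    { matching = []
    ; isMatching = [] , []
    ; cover = λ _ → false
    ; covers = λ a b e → contradiction (deg-pos {E = E} e) (λ 1≤deg → contradiction (deg≡0 a) (>⇒≢ 1≤deg))
    ; size≤length = ≤-reflexive (sum-zero {n})
    }

  module _ (col : Fin n → Bool) where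

    Smaller : Rel n → Set
    Smaller E = ∀ E′ → IsBipartite col E′ → edgeCount E′ < edgeCount E → KönigCertificate E′

    module _ {E : Rel n} (smaller : Smaller E) (bip : IsBipartite col E) where
      open IsBipartite bip

      solve-remove : ∀ {P : Fin n → Fin n → Set} (P? : ∀ a b → Dec (P a b)) → (∀ {a b} → P a b → P b a) →
                     ∀ {u v} → E u v ≡ true → P u v → KönigCertificate (remove P? E)
      solve-remove P? P-sym euv p = smaller _ (remove-isBipartite P? P-sym bip) (edgeCount-remove P? euv p)

      leaf-step : ∀ {x y} → E x y ≡ true → (∀ {z} → E x z ≡ true → z ≡ y) → KönigCertificate E
      leaf-step {x} {y} exy only-y = record
        { matching = (x , y) ∷ matching
        ; isMatching = exy ∷ All.map remove-⊆′ (proj₁ isMatching)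
                     , (x≢y ∷ proj₁ fresh) ∷ proj₂ fresh ∷ proj₂ isMatching
        ; cover = insert y cover
        ; covers = covers-deleteVertex covers
        ; size≤length = ≤-trans (size-insert y cover) (s≤s size≤length)
        }
        where
        open KönigCertificate (solve-remove (touches? y) Touches-sym exy (inj₂ refl))
        remove-⊆′ : ∀ {a b} → deleteVertex y E a b ≡ true → E a b ≡ true
        remove-⊆′ = remove-⊆ (touches? y) {E}
        x≢y : x ≢ y
        x≢y refl = irreflexive exy
        x≢ : ∀ {a b} → E a b ≡ true → b ≢ y → x ≢ a
        x≢ eab b≢y refl = b≢y (only-y eab)
        fresh : All (x ≢_) (endpoints matching) × All (y ≢_) (endpoints matching)
        fresh = All.unzip (All-endpoints both (proj₁ isMatching))
          where
          both : ∀ {a b} → deleteVertex y E a b ≡ true → (x ≢ a × y ≢ a) × (x ≢ b × y ≢ b)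
          both e with remove⁻ (touches? y) {E} e
          ... | eab , ¬touch = (x≢ eab (¬touch ∘ inj₂) , ¬touch ∘ inj₁ ∘ sym)
                             , (x≢ (symmetric eab) (¬touch ∘ inj₁) , ¬touch ∘ inj₂ ∘ sym)

      -- Rizzi's step: either v is essential, or the edge ua is inessential.
      exchange-step : ∀ {u v a} → (P₁ : KönigCertificate (deleteVertex v E)) → E u v ≡ true → E u a ≡ true →
                      a ≢ v → ¬ (u — a ∈ KönigCertificate.matching P₁) → KönigCertificate E
      exchange-step {u} {v} {a} P₁ euv eua a≢v ua∉M₁ =
        choose (length P₁.matching <? length P₂.matching)
        where
        module P₁ = KönigCertificate P₁
        P₂ = solve-remove (joins? u a) Joins-sym eua (inj₁ (refl , refl))
        module P₂ = KönigCertificate P₂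

        uv∈E₂ : deleteEdge u a E u v ≡ true
        uv∈E₂ = remove⁺ (joins? u a) {E} euv λ
          { (inj₁ (_ , v≡a)) → a≢v (sym v≡a)
          ; (inj₂ (_ , refl)) → irreflexive euv
          }

        M₁-avoids : All (λ e → (P₂.cover (proj₁ e) ≡ true ⊎ P₂.cover (proj₂ e) ≡ true) × proj₁ e ≢ v × proj₂ e ≢ v)
                        P₁.matching
        M₁-avoids = All.map (λ (exz , x≢v , z≢v) → P₂.covers _ _ exz , x≢v , z≢v)
                            (matching-deleteEdge (proj₁ P₁.isMatching) ua∉M₁)

        u∈C₂ : length P₂.matching ≤ length P₁.matching → P₂.cover u ≡ true
        u∈C₂ M₂≤M₁ with P₂.covers u v uv∈E₂
        ... | inj₁ Cu = Cu
        ... | inj₂ Cv = contradiction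
          (≤-trans (matching<cover (proj₂ P₁.isMatching) M₁-avoids Cv) (≤-trans P₂.size≤length M₂≤M₁))
          (n≮n _)

        choose : Dec (length P₁.matching < length P₂.matching) → KönigCertificate E
        choose (yes M₁<M₂) = record
          { matching = P₂.matching
          ; isMatching = IsMatching-mono (remove-⊆ (joins? u a) {E}) P₂.isMatching
          ; cover = insert v P₁.cover
          ; covers = covers-deleteVertex P₁.covers
          ; size≤length = ≤-trans (size-insert v P₁.cover) (≤-trans (s≤s P₁.size≤length) M₁<M₂)
          }
        choose (no M₁≮M₂) = record
          { matching = P₁.matching
          ; isMatching = IsMatching-mono (remove-⊆ (touches? v) {E}) P₁.isMatching
          ; cover = P₂.cover
          ; covers = covers-deleteEdge (u∈C₂ (≮⇒≥ M₁≮M₂)) P₂.covers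
          ; size≤length = ≤-trans P₂.size≤length (≮⇒≥ M₁≮M₂)
          }

      branching-step : ∀ {u v a₁ a₂} → E u v ≡ true → E u a₁ ≡ true → E u a₂ ≡ true →
                       a₁ ≢ v → a₂ ≢ v → a₁ ≢ a₂ → KönigCertificate E
      branching-step {u} {v} {a₁} {a₂} euv eua₁ eua₂ a₁≢v a₂≢v a₁≢a₂
        with solve-remove (touches? v) Touches-sym euv (inj₂ refl)
      ... | P₁ with —∈? u a₁ (KönigCertificate.matching P₁)
      ...   | no ua₁∉M₁ = exchange-step P₁ euv eua₁ a₁≢v ua₁∉M₁
      ...   | yes ua₁∈M₁ = exchange-step P₁ euv eua₂ a₂≢v λ ua₂∈M₁ →
        a₁≢a₂ (partner-unique _ (proj₂ (KönigCertificate.isMatching P₁)) ua₁∈M₁ ua₂∈M₁)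

      side : Bool → Subset n
      side c a = does (col a B.≟ c) ∧ isPos (deg E a)

      side-covers : ∀ c → Covers E (side c)
      side-covers c a b e with col a B.≟ c | col b B.≟ c
      ... | yes _ | _ = inj₁ (≢0⇒isPos (>⇒≢ (deg-pos {E = E} e)))
      ... | no _ | yes _ = inj₂ (≢0⇒isPos (>⇒≢ (deg-pos {E = E} (symmetric e))))
      ... | no a≢c | no b≢c = contradiction (trans (¬-not a≢c) (sym (¬-not b≢c))) (bichromatic e)

      sides≤deg : (∀ a → deg E a ≡ 0 ⊎ deg E a ≡ 2) → ∀ a → 2 * (𝟙 (side true a) + 𝟙 (side false a)) ≤ deg E a
      sides≤deg deg∈ a with col a | deg∈ a
      ... | true | inj₁ d≡0 rewrite d≡0 = z≤n
      ... | true | inj₂ d≡2 rewrite d≡2 = ≤-refl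
      ... | false | inj₁ d≡0 rewrite d≡0 = z≤n
      ... | false | inj₂ d≡2 rewrite d≡2 = ≤-refl

      -- E is a disjoint union of even cycles: counting edges shows that the smaller side of the
      -- bipartition, which is a cover, is no larger than the matching found for E without uv.
      cycle-step : ∀ {u v} → E u v ≡ true → (∀ a → deg E a ≡ 0 ⊎ deg E a ≡ 2) → KönigCertificate E
      cycle-step {u} {v} euv deg∈ =
        [ choose true , choose false ]′ (one-side-small (size L) (size R) (length M₂) bound)
        where
        P₂ = solve-remove (joins? u v) Joins-sym euv (inj₁ (refl , refl))
        open KönigCertificate P₂ renaming (matching to M₂; cover to C₂)
        E₂ = deleteEdge u v E
        E₂⊆E : ∀ {a b} → E₂ a b ≡ true → E a b ≡ true
        E₂⊆E = remove-⊆ (joins? u v) {E}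
        symmetric₂ : ∀ {a b} → E₂ a b ≡ true → E₂ b a ≡ true
        symmetric₂ = IsBipartite.symmetric (remove-isBipartite (joins? u v) Joins-sym bip)
        C₂-deg≤2 : ∀ a → 𝟙 (C₂ a) * deg E₂ a ≤ 2 * 𝟙 (C₂ a)
        C₂-deg≤2 a = begin
          𝟙 (C₂ a) * deg E₂ a ≤⟨ *-monoʳ-≤ (𝟙 (C₂ a)) (≤-trans (deg-mono {E = E} {E₂} E₂⊆E) (deg≤2 a)) ⟩
          𝟙 (C₂ a) * 2        ≡⟨ *-comm (𝟙 (C₂ a)) 2 ⟩
          2 * 𝟙 (C₂ a)        ∎
          where
          open ≤-Reasoning
          deg≤2 : ∀ a → deg E a ≤ 2
          deg≤2 a with deg∈ a
          ... | inj₁ d≡0 = ≤-trans (≤-reflexive d≡0) z≤n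
          ... | inj₂ d≡2 = ≤-reflexive d≡2
        L R : Subset n
        L = side true
        R = side false
        bound : 2 * (size L + size R) ≤ 4 * length M₂ + 2
        bound = begin
          2 * (size L + size R)
            ≡⟨ cong (2 *_) (∑-distrib-+ (𝟙 ∘ L) (𝟙 ∘ R)) ⟨
          2 * sum (λ a → 𝟙 (L a) + 𝟙 (R a))
            ≡⟨ *-distribˡ-sum 2 (λ a → 𝟙 (L a) + 𝟙 (R a)) ⟩
          sum (λ a → 2 * (𝟙 (L a) + 𝟙 (R a)))
            ≤⟨ sum-mono-≤ (sides≤deg deg∈) ⟩
          edgeCount E
            ≤⟨ edgeCount-deleteEdge {E = E} u v ⟩
          edgeCount E₂ + 2
            ≤⟨ +-monoˡ-≤ 2 (edgeCount≤2*cover symmetric₂ covers) ⟩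
          2 * sum (λ a → 𝟙 (C₂ a) * deg E₂ a) + 2
            ≤⟨ +-monoˡ-≤ 2 (*-monoʳ-≤ 2 (sum-mono-≤ C₂-deg≤2)) ⟩
          2 * sum (λ a → 2 * 𝟙 (C₂ a)) + 2
            ≡⟨ cong (λ x → 2 * x + 2) (*-distribˡ-sum 2 (𝟙 ∘ C₂)) ⟨
          2 * (2 * size C₂) + 2
            ≡⟨ cong (_+ 2) (*-assoc 2 2 (size C₂)) ⟨
          4 * size C₂ + 2
            ≤⟨ +-monoˡ-≤ 2 (*-monoʳ-≤ 4 size≤length) ⟩
          4 * length M₂ + 2
            ∎
          where open ≤-Reasoning
        choose : ∀ c → size (side c) ≤ length M₂ → KönigCertificate E
        choose c small = record
          { matching = M₂
          ; isMatching = IsMatching-mono E₂⊆E isMatching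
          ; cover = side c
          ; covers = side-covers c
          ; size≤length = small
          }

      step : KönigCertificate E
      step with any? (λ a → 3 ≤? deg E a) | any? (λ a → deg E a ℕ.≟ 1) | any? (λ a → 1 ≤? deg E a)
      ... | yes (u , 3≤d) | _ | _ =
        let (_ , euv , eua₁ , eua₂ , a₁≢v , a₂≢v , a₁≢a₂) = three-neighbours {E = E} 3≤d
        in branching-step euv eua₁ eua₂ a₁≢v a₂≢v a₁≢a₂
      ... | no _ | yes (x , d≡1) | _ =
        let (y , exy) = neighbour {E = E} (≤-reflexive (sym d≡1))
        in leaf-step exy (deg≡1⇒unique-neighbour {E = E} d≡1 exy)
      ... | no ≱3 | no ≢1 | yes (u , 1≤d) =
        let (v , euv) = neighbour {E = E} 1≤d
        in cycle-step euv (deg∈0,2 {E = E} (λ a 3≤ → ≱3 (a , 3≤)) (λ a ≡1 → ≢1 (a , ≡1)))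
      ... | no _ | no _ | no ≱1 = edgeless-certificate (λ a → n<1⇒n≡0 (≰⇒> (λ 1≤ → ≱1 (a , 1≤))))

    König : ∀ {E} → IsBipartite col E → KönigCertificate E
    König {E} bip = by-edgeCount (edgeCount E) bip ≤-refl
      where
      by-edgeCount : ∀ k {E} → IsBipartite col E → edgeCount E ≤ k → KönigCertificate E
      by-edgeCount zero bip ≤0 = step (λ _ _ <0 → contradiction (≤-trans <0 ≤0) λ ()) bip
      by-edgeCount (suc k) bip ≤k = step (λ _ bip′ smaller → by-edgeCount k bip′ (≤-pred (≤-trans smaller ≤k))) bip

module Duality where

  open import Data.Nat
  open import Data.Nat.Properties
  open import Data.Nat.Solver using (module +-*-Solver)
  open import Algebra.Properties.CommutativeSemigroup *-commutativeSemigroup using (x∙yz≈y∙xz)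
  open import Data.Bool using (Bool; true; false; not)
  open import Data.Fin using (Fin)
  open import Data.Fin.Properties using (any?)
  open import Data.Product using (_×_; _,_; proj₁; proj₂)
  open import Data.Sum using (_⊎_; inj₁; inj₂)
  open import Function using (_∘_)
  open import Relation.Binary.PropositionalEquality
  open import Relation.Nullary using (yes; no)
  open import Relation.Nullary.Decidable using (_×-dec_)
  open import Relation.Nullary.Negation using (contradiction)
  open Sums
  open Matchings using (Subset; size)
  open +-*-Solver

  m+n≤o⇒n≤o∸m : ∀ m {n o} → m + n ≤ o → n ≤ o ∸ m
  m+n≤o⇒n≤o∸m m {n} {o} m+n≤o = subst (_≤ o ∸ m) (m+n∸m≡n m n) (∸-monoˡ-≤ m m+n≤o)

  ∸+∸-≥ : ∀ a b p q r → p + q + r ≤ a + b → r ≤ (a ∸ p) + (b ∸ q)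
  ∸+∸-≥ a b p q r p+q+r≤a+b = +-cancelˡ-≤ (p + q) r _ (begin
    p + q + r                     ≤⟨ p+q+r≤a+b ⟩
    a + b                         ≤⟨ +-mono-≤ (m≤n+m∸n a p) (m≤n+m∸n b q) ⟩
    p + (a ∸ p) + (q + (b ∸ q))   ≡⟨ solve 4 (λ p x q y → p :+ x :+ (q :+ y) := p :+ q :+ (x :+ y)) refl p (a ∸ p) q (b ∸ q) ⟩
    p + q + ((a ∸ p) + (b ∸ q))   ∎)
    where open ≤-Reasoning

  ∸+∸-≤ : ∀ a b p q r → p ≤ a → q ≤ b → a + b ≤ p + q + r → (a ∸ p) + (b ∸ q) ≤ r
  ∸+∸-≤ a b p q r p≤a q≤b a+b≤p+q+r = +-cancelˡ-≤ (p + q) _ r (begin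
    p + q + ((a ∸ p) + (b ∸ q))   ≡⟨ solve 4 (λ p x q y → p :+ q :+ (x :+ y) := (x :+ p) :+ (y :+ q)) refl p (a ∸ p) q (b ∸ q) ⟩
    (a ∸ p + p) + (b ∸ q + q)     ≡⟨ cong₂ _+_ (m∸n+n≡m p≤a) (m∸n+n≡m q≤b) ⟩
    a + b                         ≤⟨ a+b≤p+q+r ⟩
    p + q + r                     ∎)
    where open ≤-Reasoning

  ⊓+⊓-≥ : ∀ m a b → m ≤ a + b → m ≤ m ⊓ a + m ⊓ b
  ⊓+⊓-≥ m a b m≤a+b with m ≤? a | m ≤? b
  ... | yes m≤a | _ rewrite m≤n⇒m⊓n≡m m≤a = m≤m+n m _
  ... | no _ | yes m≤b rewrite m≤n⇒m⊓n≡m m≤b = m≤n+m m _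
  ... | no m≰a | no m≰b rewrite m≥n⇒m⊓n≡n (<⇒≤ (≰⇒> m≰a)) | m≥n⇒m⊓n≡n (<⇒≤ (≰⇒> m≰b)) = m≤a+b

  2s+m≤1+U⇒s≤U∸s : ∀ {U s m} → 1 ≤ m → 2 * s + m ≤ suc U → s ≤ U ∸ s
  2s+m≤1+U⇒s≤U∸s {U} {s} {m} 1≤m 2s+m≤1+U = m+n≤o⇒n≤o∸m s (≤-pred (begin
    suc (s + s)      ≡⟨ cong suc (cong (s +_) (+-identityʳ s)) ⟨
    suc (2 * s)      ≡⟨ +-comm 1 (2 * s) ⟩
    2 * s + 1        ≤⟨ +-monoʳ-≤ (2 * s) 1≤m ⟩
    2 * s + m        ≤⟨ 2s+m≤1+U ⟩
    suc U            ∎))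
    where open ≤-Reasoning

  module DualWeights (U s m : ℕ) (2s+m≤1+U : 2 * s + m ≤ suc U) where

    yL : ℕ → ℕ
    yL x = m ⊓ (suc x ∸ s)

    yR : ℕ → ℕ
    yR z = m ⊓ (z + s + m ∸ U)

    dual : Bool → ℕ → ℕ
    dual true = yL
    dual false = yR

    dual≤m : ∀ c d → dual c d ≤ m
    dual≤m true _ = m⊓n≤m m _
    dual≤m false _ = m⊓n≤m m _

    yL+yR-≥ : ∀ x z → U ≤ x + z + 1 → m ≤ yL x + yR z
    yL+yR-≥ x z U≤x+z+1 = ⊓+⊓-≥ m _ _ (∸+∸-≥ (suc x) (z + s + m) s U m (begin
      s + U + m               ≤⟨ +-monoˡ-≤ m (+-monoʳ-≤ s U≤x+z+1) ⟩
      s + (x + z + 1) + m     ≡⟨ solve 4 (λ s x z m → s :+ (x :+ z :+ con 1) :+ m := con 1 :+ x :+ (z :+ s :+ m)) refl s x z m ⟩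
      suc x + (z + s + m)     ∎))
      where open ≤-Reasoning

    yL+yR-≤ : ∀ x z → x + z ≤ U → yL x + yR z ≤ suc m
    yL+yR-≤ x z x+z≤U with suc x ≤? s | z + s + m ≤? U
    ... | yes 1+x≤s | _ rewrite m≤n⇒m∸n≡0 1+x≤s | m≥n⇒m⊓n≡n (z≤n {m}) = ≤-trans (m⊓n≤m m _) (n≤1+n m)
    ... | no _ | yes z+s+m≤U rewrite m≤n⇒m∸n≡0 z+s+m≤U | m≥n⇒m⊓n≡n (z≤n {m}) | +-identityʳ (m ⊓ (suc x ∸ s)) =
      ≤-trans (m⊓n≤m m _) (n≤1+n m)
    ... | no 1+x≰s | no z+s+m≰U = ≤-trans (+-mono-≤ (m⊓n≤n m _) (m⊓n≤n m _))
      (∸+∸-≤ (suc x) (z + s + m) s U (suc m) (<⇒≤ (≰⇒> 1+x≰s)) (<⇒≤ (≰⇒> z+s+m≰U)) (begin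
        suc x + (z + s + m)     ≡⟨ solve 4 (λ s x z m → con 1 :+ x :+ (z :+ s :+ m) := s :+ (x :+ z) :+ (con 1 :+ m)) refl s x z m ⟩
        s + (x + z) + suc m     ≤⟨ +-monoˡ-≤ (suc m) (+-monoʳ-≤ s x+z≤U) ⟩
        s + U + suc m           ∎))
      where open ≤-Reasoning

    dual+dual-≥ : ∀ c c′ → c ≢ c′ → ∀ x z → U ≤ x + z + 1 → m ≤ dual c x + dual c′ z
    dual+dual-≥ true false _ x z U≤ = yL+yR-≥ x z U≤
    dual+dual-≥ false true _ x z U≤ = subst (m ≤_) (+-comm (yL z) (yR x)) (yL+yR-≥ z x (subst (λ t → U ≤ t + 1) (+-comm x z) U≤))
    dual+dual-≥ true true c≢c′ = contradiction refl c≢c′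
    dual+dual-≥ false false c≢c′ = contradiction refl c≢c′

    dual+dual-≤ : ∀ c c′ → c ≢ c′ → ∀ x z → x + z ≤ U → dual c x + dual c′ z ≤ suc m
    dual+dual-≤ true false _ x z ≤U = yL+yR-≤ x z ≤U
    dual+dual-≤ false true _ x z ≤U = subst (_≤ suc m) (+-comm (yL z) (yR x)) (yL+yR-≤ z x (subst (_≤ U) (+-comm x z) ≤U))
    dual+dual-≤ true true c≢c′ = contradiction refl c≢c′
    dual+dual-≤ false false c≢c′ = contradiction refl c≢c′

    dual-support : ∀ c x → 0 < dual c x → s ≤ x
    dual-support true x y>0 with suc x ≤? s
    ... | yes 1+x≤s rewrite m≤n⇒m∸n≡0 1+x≤s | m≥n⇒m⊓n≡n (z≤n {m}) = contradiction y>0 (n≮n 0)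
    ... | no 1+x≰s = ≤-pred (≰⇒> 1+x≰s)
    dual-support false z y>0 with z + s + m ≤? U
    ... | yes ≤U rewrite m≤n⇒m∸n≡0 ≤U | m≥n⇒m⊓n≡n (z≤n {m}) = contradiction y>0 (n≮n 0)
    ... | no ≰U = +-cancelʳ-≤ (s + m) s z (begin
      s + (s + m)   ≡⟨ solve 2 (λ s m → s :+ (s :+ m) := con 2 :* s :+ m) refl s m ⟩
      2 * s + m     ≤⟨ 2s+m≤1+U ⟩
      suc U         ≤⟨ ≰⇒> ≰U ⟩
      z + s + m     ≡⟨ +-assoc z s m ⟩
      z + (s + m)   ∎)
      where open ≤-Reasoning

  module CoverCounting {n : ℕ} (w : Fin n → Fin n → ℕ) (w-sym : ∀ a b → w a b ≡ w b a)
                       (C : Subset n) (covers : ∀ a b → w a b ≢ 0 → C a ≡ true ⊎ C b ≡ true)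
                       (y : Fin n → ℕ) (k s U : ℕ) (y≤k : ∀ v → y v ≤ k)
                       (H-edge : ∀ a b → w a b ≢ 0 → sum (w a) + sum (w b) ≤ U × y a + y b ≤ k)
                       (support : ∀ v → 0 < y v → s ≤ sum (w v)) where

    d : Fin n → ℕ
    d v = sum (w v)

    inflow : Fin n → ℕ
    inflow c = sum (λ v → w c v * y v)

    inside outside : Fin n → ℕ
    inside v = 𝟙 (C v) * y v
    outside v = 𝟙 (not (C v)) * y v

    -- A vertex with a neighbour of positive weight has degree at most U - s.
    neighbourhood-bound : ∀ c → inflow c ≤ (U ∸ s) * (k ∸ y c)
    neighbourhood-bound c with any? (λ v → (0 <? w c v) ×-dec (0 <? y v))
    ... | no none = ≤-trans (sum-mono-≤ {g = λ _ → 0} vanish) (≤-trans (≤-reflexive (sum-zero {n})) z≤n)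
      where
      vanish : ∀ v → w c v * y v ≤ 0
      vanish v with w c v in wcv | y v in yv
      ... | zero | _ = z≤n
      ... | suc w′ | zero = ≤-reflexive (*-zeroʳ (suc w′))
      ... | suc _ | suc _ = contradiction (v , subst (0 <_) (sym wcv) z<s , subst (0 <_) (sym yv) z<s) none
    ... | yes (v , wcv>0 , yv>0) = begin
      inflow c                       ≤⟨ sum-mono-≤ capped ⟩
      sum (λ v → w c v * (k ∸ y c))  ≡⟨ *-distribʳ-sum (k ∸ y c) (w c) ⟨
      d c * (k ∸ y c)                ≤⟨ *-monoˡ-≤ (k ∸ y c) dc≤U∸s ⟩
      (U ∸ s) * (k ∸ y c)            ∎
      where
      open ≤-Reasoning
      capped : ∀ v → w c v * y v ≤ w c v * (k ∸ y c)
      capped v with w c v ≟ 0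
      ... | yes wcv≡0 rewrite wcv≡0 = z≤n
      ... | no wcv≢0 = *-monoʳ-≤ (w c v) (m+n≤o⇒n≤o∸m (y c) (proj₂ (H-edge c v wcv≢0)))
      dc≤U∸s : d c ≤ U ∸ s
      dc≤U∸s = m+n≤o⇒n≤o∸m s (begin
        s + d c   ≤⟨ +-monoˡ-≤ (d c) (support v yv>0) ⟩
        d v + d c ≡⟨ +-comm (d v) (d c) ⟩
        d c + d v ≤⟨ proj₁ (H-edge c v (>⇒≢ wcv>0)) ⟩
        U         ∎)

    outside-bound : s * sum outside ≤ sum (λ c → 𝟙 (C c) * inflow c)
    outside-bound = begin
      s * sum outside
        ≡⟨ *-distribˡ-sum s outside ⟩
      sum (λ v → s * outside v)
        ≤⟨ sum-mono-≤ spread ⟩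
      sum (λ v → sum (λ c → 𝟙 (not (C v)) * (w v c * y v)))
        ≤⟨ sum-mono-≤ (λ v → sum-mono-≤ (crossing v)) ⟩
      sum (λ v → sum (λ c → 𝟙 (C c) * (w c v * y v)))
        ≡⟨ ∑-comm (λ v c → 𝟙 (C c) * (w c v * y v)) ⟩
      sum (λ c → sum (λ v → 𝟙 (C c) * (w c v * y v)))
        ≡⟨ sum-cong-≗ (λ c → *-distribˡ-sum (𝟙 (C c)) (λ v → w c v * y v)) ⟨
      sum (λ c → 𝟙 (C c) * inflow c)
        ∎
      where
      open ≤-Reasoning
      spread : ∀ v → s * (𝟙 (not (C v)) * y v) ≤ sum (λ c → 𝟙 (not (C v)) * (w v c * y v))
      spread v = begin
        s * (𝟙 (not (C v)) * y v)                ≡⟨ *-comm s _ ⟩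
        𝟙 (not (C v)) * y v * s                  ≡⟨ *-assoc (𝟙 (not (C v))) (y v) s ⟩
        𝟙 (not (C v)) * (y v * s)                ≤⟨ *-monoʳ-≤ (𝟙 (not (C v))) ys≤yd ⟩
        𝟙 (not (C v)) * (y v * d v)              ≡⟨ cong (𝟙 (not (C v)) *_) (*-distribˡ-sum (y v) (w v)) ⟩
        𝟙 (not (C v)) * sum (λ c → y v * w v c)  ≡⟨ *-distribˡ-sum (𝟙 (not (C v))) (λ c → y v * w v c) ⟩
        sum (λ c → 𝟙 (not (C v)) * (y v * w v c)) ≡⟨ sum-cong-≗ (λ c → cong (𝟙 (not (C v)) *_) (*-comm (y v) (w v c))) ⟩
        sum (λ c → 𝟙 (not (C v)) * (w v c * y v)) ∎
        where
        ys≤yd : y v * s ≤ y v * d v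
        ys≤yd with y v in yv
        ... | zero = z≤n
        ... | suc y′ = *-monoʳ-≤ (suc y′) (support v (subst (0 <_) (sym yv) z<s))
      crossing : ∀ v c → 𝟙 (not (C v)) * (w v c * y v) ≤ 𝟙 (C c) * (w c v * y v)
      crossing v c with C v in Cv | w v c ≟ 0
      ... | true | _ = z≤n
      ... | false | yes wvc≡0 rewrite wvc≡0 = z≤n
      ... | false | no wvc≢0 with covers v c wvc≢0
      ...   | inj₁ Cv≡true = contradiction (trans (sym Cv) Cv≡true) λ ()
      ...   | inj₂ Cc rewrite Cc | w-sym v c = ≤-refl

    cover-vertex-bound : s ≤ U ∸ s → ∀ c → s * y c + (U ∸ s) * (k ∸ y c) ≤ (U ∸ s) * k
    cover-vertex-bound s≤U∸s c = begin
      s * y c + (U ∸ s) * (k ∸ y c)        ≤⟨ +-monoˡ-≤ _ (*-monoˡ-≤ (y c) s≤U∸s) ⟩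
      (U ∸ s) * y c + (U ∸ s) * (k ∸ y c)  ≡⟨ *-distribˡ-+ (U ∸ s) (y c) (k ∸ y c) ⟨
      (U ∸ s) * (y c + (k ∸ y c))          ≡⟨ cong ((U ∸ s) *_) (m+[n∸m]≡n (y≤k c)) ⟩
      (U ∸ s) * k                          ∎
      where open ≤-Reasoning

    cover-count : s ≤ U ∸ s → s * sum y ≤ size C * ((U ∸ s) * k)
    cover-count s≤U∸s = begin
      s * sum y
        ≡⟨ cong (s *_) (trans (sum-cong-≗ split) (∑-distrib-+ inside outside)) ⟩
      s * (sum inside + sum outside)
        ≡⟨ *-distribˡ-+ s (sum inside) (sum outside) ⟩
      s * sum inside + s * sum outside
        ≤⟨ +-monoʳ-≤ (s * sum inside) outside-bound ⟩
      s * sum inside + sum (λ c → 𝟙 (C c) * inflow c)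
        ≤⟨ +-monoʳ-≤ (s * sum inside) (sum-mono-≤ (λ c → *-monoʳ-≤ (𝟙 (C c)) (neighbourhood-bound c))) ⟩
      s * sum inside + sum (λ c → 𝟙 (C c) * R c)
        ≡⟨ cong (_+ sum (λ c → 𝟙 (C c) * R c))
                (trans (*-distribˡ-sum s inside) (sum-cong-≗ (λ c → x∙yz≈y∙xz s (𝟙 (C c)) (y c)))) ⟩
      sum (λ c → 𝟙 (C c) * (s * y c)) + sum (λ c → 𝟙 (C c) * R c)
        ≡⟨ ∑-distrib-+ (λ c → 𝟙 (C c) * (s * y c)) (λ c → 𝟙 (C c) * R c) ⟨
      sum (λ c → 𝟙 (C c) * (s * y c) + 𝟙 (C c) * R c)
        ≡⟨ sum-cong-≗ (λ c → *-distribˡ-+ (𝟙 (C c)) (s * y c) (R c)) ⟨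
      sum (λ c → 𝟙 (C c) * (s * y c + R c))
        ≤⟨ sum-mono-≤ (λ c → *-monoʳ-≤ (𝟙 (C c)) (cover-vertex-bound s≤U∸s c)) ⟩
      sum (λ c → 𝟙 (C c) * ((U ∸ s) * k))
        ≡⟨ *-distribʳ-sum ((U ∸ s) * k) (𝟙 ∘ C) ⟨
      size C * ((U ∸ s) * k)
        ∎
      where
      open ≤-Reasoning
      R : Fin n → ℕ
      R c = (U ∸ s) * (k ∸ y c)
      split : ∀ v → y v ≡ inside v + outside v
      split v with C v
      ... | true = sym (trans (+-identityʳ _) (+-identityʳ _))
      ... | false = sym (+-identityʳ _)

module Halving where

  open import Data.Nat
  open import Data.Nat.Properties
  open import Data.Nat.Solver using (module +-*-Solver)
  open import Data.Product using (_×_; _,_; proj₁; proj₂)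
  open import Relation.Binary.PropositionalEquality
  open +-*-Solver

  ⌊n/2⌋-bounds : ∀ x → 2 * ⌊ x /2⌋ ≤ x × x ≤ suc (2 * ⌊ x /2⌋)
  ⌊n/2⌋-bounds x = (begin
      2 * ⌊ x /2⌋              ≡⟨ double ⌊ x /2⌋ ⟩
      ⌊ x /2⌋ + ⌊ x /2⌋        ≤⟨ +-monoʳ-≤ ⌊ x /2⌋ (⌊n/2⌋≤⌈n/2⌉ x) ⟩
      ⌊ x /2⌋ + ⌈ x /2⌉        ≡⟨ ⌊n/2⌋+⌈n/2⌉≡n x ⟩
      x                        ∎)
    , (begin
      x                        ≡⟨ ⌊n/2⌋+⌈n/2⌉≡n x ⟨
      ⌊ x /2⌋ + ⌈ x /2⌉        ≤⟨ +-monoʳ-≤ ⌊ x /2⌋ (⌊n/2⌋-mono (n≤1+n (suc x))) ⟩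
      ⌊ x /2⌋ + suc ⌊ x /2⌋    ≡⟨ +-suc ⌊ x /2⌋ ⌊ x /2⌋ ⟩
      suc (⌊ x /2⌋ + ⌊ x /2⌋)  ≡⟨ cong suc (double ⌊ x /2⌋) ⟨
      suc (2 * ⌊ x /2⌋)        ∎)
    where
    open ≤-Reasoning
    double : ∀ h → 2 * h ≡ h + h
    double h = cong (h +_) (+-identityʳ h)

  module Threshold (U m : ℕ) (1≤m : 1 ≤ m) (m≤U : m ≤ U) where

    s : ℕ
    s = ⌊ suc U ∸ m /2⌋

    private
      x+m≡1+U : (suc U ∸ m) + m ≡ suc U
      x+m≡1+U = m∸n+n≡m (m≤n⇒m≤1+n m≤U)

    2s+m≤1+U : 2 * s + m ≤ suc U
    2s+m≤1+U = subst (2 * s + m ≤_) x+m≡1+U (+-monoˡ-≤ m (proj₁ (⌊n/2⌋-bounds (suc U ∸ m))))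

    U≤2s+m : U ≤ 2 * s + m
    U≤2s+m = ≤-pred (subst (_≤ suc (2 * s) + m) x+m≡1+U (+-monoˡ-≤ m (proj₂ (⌊n/2⌋-bounds (suc U ∸ m)))))

    s<U : s < U
    s<U with s | 2s+m≤1+U
    ... | zero | _ = ≤-trans 1≤m m≤U
    ... | suc s′ | 2s+m≤1+U′ = ≤-pred (begin
      suc (suc (suc s′))         ≤⟨ s≤s (s≤s (m≤m+n (suc s′) s′)) ⟩
      suc (suc (suc s′ + s′))    ≡⟨ solve 1 (λ s → con 2 :+ (con 1 :+ s :+ s) := con 2 :* (con 1 :+ s) :+ con 1) refl s′ ⟩
      2 * suc s′ + 1             ≤⟨ +-monoʳ-≤ (2 * suc s′) 1≤m ⟩
      2 * suc s′ + m             ≤⟨ 2s+m≤1+U′ ⟩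
      suc U                      ∎)
      where open ≤-Reasoning

    2[U∸s]≤U+m : 2 * (U ∸ s) ≤ U + m
    2[U∸s]≤U+m = +-cancelʳ-≤ (2 * s) _ _ (begin
      2 * (U ∸ s) + 2 * s        ≡⟨ *-distribˡ-+ 2 (U ∸ s) s ⟨
      2 * (U ∸ s + s)            ≡⟨ cong (2 *_) (m∸n+n≡m (<⇒≤ s<U)) ⟩
      2 * U                      ≡⟨ cong (U +_) (+-identityʳ U) ⟩
      U + U                      ≤⟨ +-monoʳ-≤ U U≤2s+m ⟩
      U + (2 * s + m)            ≡⟨ solve 3 (λ U t m → U :+ (t :+ m) := U :+ m :+ t) refl U (2 * s) m ⟩
      U + m + 2 * s              ∎)
      where open ≤-Reasoning

module IntegralBound where

  open import Data.Nat
  open import Data.Nat.Properties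
  open import Data.Fin using (Fin)
  open import Data.Bool using (Bool)
  open import Data.List using (length)
  open import Data.List.Relation.Unary.All as All using (All)
  open import Data.Product using (_,_; proj₁; proj₂)
  open import Relation.Binary.PropositionalEquality
  open import Function using (_∘′_)
  open import Defs
  open Sums using (sum; sum-allFin; isPos; isPos⇒≢0; ≢0⇒isPos)
  open Matchings using (size; matching-size-bound; IsMatching-mono)
  open Konig using (IsBipartite; KönigCertificate; König)
  open Duality

  module _ (G : Graph) (bip : Bipartite G) (H : WeightedSubgraph G) (U : ℕ)
           (H-edge : ∀ a b → InH H a b → degH H a + degH H b ≤ U)
           (G-edge : ∀ a b → Adj G a b → U ≤ degH H a + degH H b + 1) where

    col : Fin (n G) → Bool
    col = proj₁ bip

    bichromatic : ∀ {a b} → Adj G a b → col a ≢ col b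
    bichromatic = proj₂ bip

    d : Fin (n G) → ℕ
    d v = sum (w H v)

    degH≡d : ∀ v → degH H v ≡ d v
    degH≡d v = sum-allFin (w H v)

    support : Fin (n G) → Fin (n G) → Bool
    support a b = isPos (w H a b)

    support-isBipartite : IsBipartite col support
    support-isBipartite = record
      { symmetric = λ {a} {b} e → ≢0⇒isPos (isPos⇒≢0 e ∘′ trans (w-sym H a b))
      ; bichromatic = λ {a} {b} e → bichromatic (w-sub H a b (isPos⇒≢0 e))
      }

    integral-edcs-bound : ∀ s m → 1 ≤ m → 2 * s + m ≤ suc U → ∀ {μG μH} →
      IsMaxMatchingSize (Adj G) μG → IsMaxMatchingSize (InH H) μH → s * (m * μG) ≤ μH * ((U ∸ s) * suc m)
    integral-edcs-bound s m 1≤m 2s+m≤1+U {μG} {μH} ((MG , (MG⊆G , MG-unique) , |MG|≡μG) , _) (_ , μH-max) = begin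
      s * (m * μG)                  ≡⟨ cong (λ l → s * (m * l)) |MG|≡μG ⟨
      s * (m * length MG)           ≤⟨ *-monoʳ-≤ s (matching-size-bound MG MG-unique m y (All.map G-edge′ MG⊆G)) ⟩
      s * sum y                     ≤⟨ cover-count (2s+m≤1+U⇒s≤U∸s 1≤m 2s+m≤1+U) ⟩
      size cover * K                ≤⟨ *-monoˡ-≤ K (≤-trans size≤length (μH-max matching matching-in-H)) ⟩
      μH * K                        ∎
      where
      open ≤-Reasoning
      open DualWeights U s m 2s+m≤1+U
      open KönigCertificate (König col support-isBipartite)
      K = (U ∸ s) * suc m
      y : Fin (n G) → ℕ
      y v = dual (col v) (d v)
      d-edge : ∀ {a b} → InH H a b → d a + d b ≤ U
      d-edge {a} {b} ab = subst₂ (λ x z → x + z ≤ U) (degH≡d a) (degH≡d b) (H-edge a b ab)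
      G-edge′ : ∀ {e} → Adj G (proj₁ e) (proj₂ e) → m ≤ y (proj₁ e) + y (proj₂ e)
      G-edge′ {a , b} adj = dual+dual-≥ (col a) (col b) (bichromatic adj) (d a) (d b)
        (subst₂ (λ x z → U ≤ x + z + 1) (degH≡d a) (degH≡d b) (G-edge a b adj))
      matching-in-H = IsMatching-mono isPos⇒≢0 isMatching
      open CoverCounting (w H) (w-sym H) cover (λ a b ab → covers a b (≢0⇒isPos ab)) y (suc m) s U
        (λ v → ≤-trans (dual≤m (col v) (d v)) (n≤1+n m))
        (λ a b ab → d-edge ab , dual+dual-≤ (col a) (col b) (bichromatic (w-sub H a b ab)) (d a) (d b) (d-edge ab))
        (λ v → dual-support (col v) (d v))

module Rationals where

  open import Data.Nat as ℕ using (ℕ; zero; suc; z≤n; s≤s)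
  import Data.Nat.Properties as ℕ
  open import Data.Nat.Coprimality using (1-coprimeTo) renaming (sym to coprime-sym)
  open import Data.Integer as ℤ using (+_; -[1+_])
  import Data.Integer.Properties as ℤ
  open import Data.Rational
  open import Data.Rational.Properties
  import Data.Rational.Unnormalised as ℚᵘ
  import Data.Rational.Unnormalised.Properties as ℚᵘ
  open import Data.Rational.Solver using (module +-*-Solver)
  open import Data.Product using (Σ; _×_; _,_; proj₁; proj₂)
  open import Relation.Binary.PropositionalEquality
  open import Relation.Nullary using (Dec; yes; no; ¬_)
  open import Relation.Nullary.Negation using (contradiction)
  open import Defs using (toℚ)
  open Halving using (module Threshold)
  open +-*-Solver

  toℚ≡mkℚ : ∀ k → toℚ k ≡ mkℚ (+ k) 0 (coprime-sym (1-coprimeTo k))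
  toℚ≡mkℚ k = ↥p/↧p≡p (mkℚ (+ k) 0 (coprime-sym (1-coprimeTo k)))

  toℚ-mono-≤ : ∀ {a b} → a ℕ.≤ b → toℚ a ≤ toℚ b
  toℚ-mono-≤ {a} {b} a≤b rewrite toℚ≡mkℚ a | toℚ≡mkℚ b =
    *≤* (subst₂ ℤ._≤_ (sym (ℤ.*-identityʳ (+ a))) (sym (ℤ.*-identityʳ (+ b))) (ℤ.+≤+ a≤b))

  toℚ-cancel-≤ : ∀ {a b} → toℚ a ≤ toℚ b → a ℕ.≤ b
  toℚ-cancel-≤ {a} {b} a≤b rewrite toℚ≡mkℚ a | toℚ≡mkℚ b with a≤b
  ... | *≤* a≤b = ℤ.drop‿+≤+ (subst₂ ℤ._≤_ (ℤ.*-identityʳ (+ a)) (ℤ.*-identityʳ (+ b)) a≤b)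

  toℚ-mono-< : ∀ {a b} → a ℕ.< b → toℚ a < toℚ b
  toℚ-mono-< {a} {b} a<b rewrite toℚ≡mkℚ a | toℚ≡mkℚ b =
    *<* (subst₂ ℤ._<_ (sym (ℤ.*-identityʳ (+ a))) (sym (ℤ.*-identityʳ (+ b))) (ℤ.+<+ a<b))

  toℚ-cancel-< : ∀ {a b} → toℚ a < toℚ b → a ℕ.< b
  toℚ-cancel-< {a} {b} a<b rewrite toℚ≡mkℚ a | toℚ≡mkℚ b with a<b
  ... | *<* a<b = ℤ.drop‿+<+ (subst₂ ℤ._<_ (ℤ.*-identityʳ (+ a)) (ℤ.*-identityʳ (+ b)) a<b)

  toℚ-+ : ∀ a b → toℚ (a ℕ.+ b) ≡ toℚ a + toℚ b
  toℚ-+ a b = toℚᵘ-injective (ℚᵘ.≃-trans unnormalised (ℚᵘ.≃-sym (toℚᵘ-homo-+ (toℚ a) (toℚ b))))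
    where
    unnormalised : toℚᵘ (toℚ (a ℕ.+ b)) ℚᵘ.≃ (toℚᵘ (toℚ a) ℚᵘ.+ toℚᵘ (toℚ b))
    unnormalised rewrite toℚ≡mkℚ (a ℕ.+ b) | toℚ≡mkℚ a | toℚ≡mkℚ b =
      ℚᵘ.*≡* (trans (ℤ.*-identityʳ _) (trans (ℤ.pos-+ a b)
        (sym (trans (ℤ.*-identityʳ _) (cong₂ ℤ._+_ (ℤ.*-identityʳ (+ a)) (ℤ.*-identityʳ (+ b)))))))

  toℚ-* : ∀ a b → toℚ (a ℕ.* b) ≡ toℚ a * toℚ b
  toℚ-* a b = toℚᵘ-injective (ℚᵘ.≃-trans unnormalised (ℚᵘ.≃-sym (toℚᵘ-homo-* (toℚ a) (toℚ b))))
    where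
    unnormalised : toℚᵘ (toℚ (a ℕ.* b)) ℚᵘ.≃ (toℚᵘ (toℚ a) ℚᵘ.* toℚᵘ (toℚ b))
    unnormalised rewrite toℚ≡mkℚ (a ℕ.* b) | toℚ≡mkℚ a | toℚ≡mkℚ b =
      ℚᵘ.*≡* (trans (ℤ.*-identityʳ _) (trans (ℤ.pos-* a b) (sym (ℤ.*-identityʳ _))))

  0≤toℚ : ∀ k → 0ℚ ≤ toℚ k
  0≤toℚ k = toℚ-mono-≤ {0} {k} z≤n

  0<toℚ : ∀ k → 0ℚ < toℚ (suc k)
  0<toℚ k = toℚ-mono-< {0} {suc k} (s≤s z≤n)

  archimedean : ∀ β → Σ ℕ λ K → β < toℚ (suc K)
  archimedean (mkℚ (+ k) d c) = k , k/d<1+k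
    where
    k/d<1+k : mkℚ (+ k) d c < toℚ (suc k)
    k/d<1+k rewrite toℚ≡mkℚ (suc k) = *<* (subst₂ ℤ._<_ (sym (ℤ.*-identityʳ (+ k))) (ℤ.pos-* (suc k) (suc d))
                                            (ℤ.+<+ (ℕ.m≤m*n (suc k) (suc d))))
  archimedean (mkℚ -[1+ k ] d c) = 0 , negative<1
    where
    negative<1 : mkℚ -[1+ k ] d c < toℚ 1
    negative<1 rewrite toℚ≡mkℚ 1 = *<* (subst₂ ℤ._<_ (sym (ℤ.*-identityʳ -[1+ k ])) (sym (ℤ.*-identityˡ (+ suc d))) ℤ.-<+)

  p≤q⇒0≤q-p : ∀ {p q} → p ≤ q → 0ℚ ≤ q - p
  p≤q⇒0≤q-p {p} {q} p≤q = subst (_≤ q - p) (+-inverseʳ p) (+-monoˡ-≤ (- p) p≤q)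

  0≤q-p⇒p≤q : ∀ {p q} → 0ℚ ≤ q - p → p ≤ q
  0≤q-p⇒p≤q {p} {q} 0≤q-p = subst₂ _≤_ (+-identityˡ p) (solve 2 (λ p q → (q :- p) :+ p := q) refl p q) (+-monoˡ-≤ p 0≤q-p)

  p<q⇒0<q-p : ∀ {p q} → p < q → 0ℚ < q - p
  p<q⇒0<q-p {p} {q} p<q = subst (_< q - p) (+-inverseʳ p) (+-monoˡ-< (- p) p<q)

  0<q-p⇒p<q : ∀ {p q} → 0ℚ < q - p → p < q
  0<q-p⇒p<q {p} {q} 0<q-p = subst₂ _<_ (+-identityˡ p) (solve 2 (λ p q → (q :- p) :+ p := q) refl p q) (+-monoˡ-< p 0<q-p)

  0≤p*q : ∀ {p q} → 0ℚ ≤ p → 0ℚ ≤ q → 0ℚ ≤ p * q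
  0≤p*q {p} {q} 0≤p 0≤q = nonNegative⁻¹ _ {{nonNeg*nonNeg⇒nonNeg p {{nonNegative 0≤p}} q {{nonNegative 0≤q}}}}

  0<p*q : ∀ {p q} → 0ℚ < p → 0ℚ < q → 0ℚ < p * q
  0<p*q {p} {q} 0<p 0<q = positive⁻¹ _ {{pos*pos⇒pos p {{positive 0<p}} q {{positive 0<q}}}}

  0≤p+q : ∀ {p q} → 0ℚ ≤ p → 0ℚ ≤ q → 0ℚ ≤ p + q
  0≤p+q {p} {q} 0≤p 0≤q = subst (_≤ p + q) (+-identityˡ 0ℚ) (+-mono-≤ 0≤p 0≤q)

  0<p+q : ∀ {p q} → 0ℚ < p → 0ℚ ≤ q → 0ℚ < p + q
  0<p+q {p} {q} 0<p 0≤q = subst (_< p + q) (+-identityʳ 0ℚ) (+-mono-<-≤ 0<p 0≤q)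

  last-true : (P : ℕ → Set) → (∀ k → Dec (P k)) → ∀ K → P 0 → ¬ P (suc K) → Σ ℕ λ r → P r × ¬ P (suc r)
  last-true P P? zero p₀ ¬p₁ = 0 , p₀ , ¬p₁
  last-true P P? (suc K) p₀ ¬pK+2 with P? (suc K)
  ... | yes pK+1 = suc K , pK+1 , ¬pK+2
  ... | no ¬pK+1 = last-true P P? K p₀ ¬pK+1

  ℕ-floor : ∀ β → 0ℚ ≤ β → Σ ℕ λ U → toℚ U ≤ β × β < toℚ (suc U)
  ℕ-floor β 0≤β with archimedean β
  ... | K , β<1+K with last-true (λ k → toℚ k ≤ β) (λ k → toℚ k ≤? β) K 0≤β (λ 1+K≤β → <-irrefl refl (<-≤-trans β<1+K 1+K≤β))
  ...   | U , U≤β , 1+U≰β = U , U≤β , ≰⇒> 1+U≰β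

  gap : ℚ → ℚ → ℚ → ℚ
  gap e u m = (u - m) * m - (1ℚ - e) * (u + m) * (1ℚ + m)

  -- gap e u is a concave quadratic in m whose maximiser is vertexNum e u / vertexDen e - 1/2.
  vertexNum : ℚ → ℚ → ℚ
  vertexNum e u = e * (1ℚ + u) + (1ℚ - e)

  vertexDen : ℚ → ℚ
  vertexDen e = toℚ 4 - toℚ 2 * e

  slack : ℚ → ℚ → ℚ
  slack e u = (1ℚ + u) * (e * e * (1ℚ + u) - toℚ 8) + toℚ 2 * e * (1ℚ + u) * (toℚ 5 - toℚ 2 * e)
            + (1ℚ - e) * (toℚ 5 - toℚ 3 * e)

  -- Completing the square in m; both factors of the last term are nonnegative exactly when
  -- m is the floor of vertexNum e u / vertexDen e.
  gap-identity : ∀ e u m → let T = vertexDen e * m - (e * (1ℚ + u) - 1ℚ) in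
    toℚ 4 * (toℚ 2 - e) * gap e u m ≡ slack e u + ((toℚ 2 - e) - T) * ((toℚ 2 - e) + T)
  gap-identity = solve 3 (λ e u m →
    con (toℚ 4) :* (con (toℚ 2) :- e) :* ((u :- m) :* m :- (con 1ℚ :- e) :* (u :+ m) :* (con 1ℚ :+ m))
    := (con 1ℚ :+ u) :* (e :* e :* (con 1ℚ :+ u) :- con (toℚ 8))
       :+ con (toℚ 2) :* e :* (con 1ℚ :+ u) :* (con (toℚ 5) :- con (toℚ 2) :* e)
       :+ (con 1ℚ :- e) :* (con (toℚ 5) :- con (toℚ 3) :* e)
       :+ ((con (toℚ 2) :- e) :- ((con (toℚ 4) :- con (toℚ 2) :* e) :* m :- (e :* (con 1ℚ :+ u) :- con 1ℚ)))
        :* ((con (toℚ 2) :- e) :+ ((con (toℚ 4) :- con (toℚ 2) :* e) :* m :- (e :* (con 1ℚ :+ u) :- con 1ℚ))))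
    refl

  slack-pos : ∀ {e u} → 0ℚ < e → e < 1ℚ → 0ℚ ≤ u → toℚ 8 < (1ℚ + u) * (e * e) → 0ℚ < slack e u
  slack-pos {e} {u} 0<e e<1 0≤u 8<Ne² =
    0<p+q (0<p+q (0<p*q 0<N 0<e²N-8) (0≤p*q (0≤p*q (0≤p*q (0≤toℚ 2) (<⇒≤ 0<e)) (<⇒≤ 0<N)) (<⇒≤ 0<5-2e)))
          (0≤p*q (<⇒≤ 0<1-e) (<⇒≤ 0<5-3e))
    where
    0<1-e : 0ℚ < 1ℚ - e
    0<1-e = p<q⇒0<q-p e<1
    0<N : 0ℚ < 1ℚ + u
    0<N = 0<p+q (0<toℚ 0) 0≤u
    0<e²N-8 : 0ℚ < e * e * (1ℚ + u) - toℚ 8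
    0<e²N-8 = subst (λ x → 0ℚ < x - toℚ 8) (*-comm (1ℚ + u) (e * e)) (p<q⇒0<q-p 8<Ne²)
    0<5-2e : 0ℚ < toℚ 5 - toℚ 2 * e
    0<5-2e = subst (0ℚ <_) (solve 1 (λ e → con (toℚ 2) :* (con 1ℚ :- e) :+ con (toℚ 3) := con (toℚ 5) :- con (toℚ 2) :* e) refl e)
      (0<p+q (0<p*q (0<toℚ 1) 0<1-e) (0≤toℚ 3))
    0<5-3e : 0ℚ < toℚ 5 - toℚ 3 * e
    0<5-3e = subst (0ℚ <_) (solve 1 (λ e → con (toℚ 3) :* (con 1ℚ :- e) :+ con (toℚ 2) := con (toℚ 5) :- con (toℚ 3) :* e) refl e)
      (0<p+q (0<p*q (0<toℚ 2) 0<1-e) (0≤toℚ 2))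

  gap-pos : ∀ {e u m} → 0ℚ < e → e < 1ℚ → 0ℚ ≤ u → toℚ 8 < (1ℚ + u) * (e * e) →
            m * vertexDen e ≤ vertexNum e u → vertexNum e u < (1ℚ + m) * vertexDen e → 0ℚ < gap e u m
  gap-pos {e} {u} {m} 0<e e<1 0≤u 8<Ne² m≤ <1+m = *-cancelˡ-<-nonNeg (toℚ 4 * (toℚ 2 - e)) {{nonNegative (<⇒≤ 0<c)}}
    (begin-strict
      toℚ 4 * (toℚ 2 - e) * 0ℚ      ≡⟨ *-zeroʳ (toℚ 4 * (toℚ 2 - e)) ⟩
      0ℚ                            <⟨ 0<p+q (slack-pos 0<e e<1 0≤u 8<Ne²) (0≤p*q 0≤below (<⇒≤ 0<above)) ⟩
      slack e u + below * above      ≡⟨ gap-identity e u m ⟨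
      toℚ 4 * (toℚ 2 - e) * gap e u m ∎)
    where
    open ≤-Reasoning
    T = vertexDen e * m - (e * (1ℚ + u) - 1ℚ)
    below = (toℚ 2 - e) - T
    above = (toℚ 2 - e) + T
    0≤below : 0ℚ ≤ below
    0≤below = subst (0ℚ ≤_) (solve 3 (λ e u m →
        (e :* (con 1ℚ :+ u) :+ (con 1ℚ :- e)) :- m :* (con (toℚ 4) :- con (toℚ 2) :* e)
        := (con (toℚ 2) :- e) :- ((con (toℚ 4) :- con (toℚ 2) :* e) :* m :- (e :* (con 1ℚ :+ u) :- con 1ℚ))) refl e u m)
      (p≤q⇒0≤q-p m≤)
    0<above : 0ℚ < above
    0<above = subst (0ℚ <_) (solve 3 (λ e u m →
        (con 1ℚ :+ m) :* (con (toℚ 4) :- con (toℚ 2) :* e) :- (e :* (con 1ℚ :+ u) :+ (con 1ℚ :- e))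
        := (con (toℚ 2) :- e) :+ ((con (toℚ 4) :- con (toℚ 2) :* e) :* m :- (e :* (con 1ℚ :+ u) :- con 1ℚ))) refl e u m)
      (p<q⇒0<q-p <1+m)
    0<c : 0ℚ < toℚ 4 * (toℚ 2 - e)
    0<c = 0<p*q (0<toℚ 3) (subst (0ℚ <_) (solve 1 (λ e → (con 1ℚ :- e) :+ con 1ℚ := con (toℚ 2) :- e) refl e)
                                          (0<p+q (p<q⇒0<q-p e<1) (0≤toℚ 1)))

  vertexNum-bounds : ∀ {e} U → 0ℚ < e → e < 1ℚ →
    0ℚ ≤ vertexNum e (toℚ U) × vertexNum e (toℚ U) < toℚ (suc (suc U)) * vertexDen e
  vertexNum-bounds {e} U 0<e e<1 = 0≤p+q (0≤p*q (<⇒≤ 0<e) 0≤N) (<⇒≤ 0<1-e) , num<[2+U]den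
    where
    0<1-e : 0ℚ < 1ℚ - e
    0<1-e = p<q⇒0<q-p e<1
    0≤N : 0ℚ ≤ 1ℚ + toℚ U
    0≤N = 0≤p+q (0≤toℚ 1) (0≤toℚ U)
    num<[2+U]den : vertexNum e (toℚ U) < toℚ (suc (suc U)) * vertexDen e
    num<[2+U]den = subst (λ x → vertexNum e (toℚ U) < x * vertexDen e) (sym (trans (toℚ-+ 1 (suc U)) (cong (λ x → 1ℚ + x) (toℚ-+ 1 U))))
      (0<q-p⇒p<q (subst (0ℚ <_) (solve 2 (λ e u →
          (con (toℚ 2) :+ (con 1ℚ :- e)) :+ (con (toℚ 3) :* (con 1ℚ :+ u) :* (con 1ℚ :- e) :+ (con 1ℚ :+ u))
          := (con 1ℚ :+ (con 1ℚ :+ u)) :* (con (toℚ 4) :- con (toℚ 2) :* e) :- (e :* (con 1ℚ :+ u) :+ (con 1ℚ :- e))) refl e (toℚ U))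
        (0<p+q (0<p+q (0<toℚ 1) (<⇒≤ 0<1-e)) (0≤p+q (0≤p*q (0≤p*q (0≤toℚ 3) 0≤N) (<⇒≤ 0<1-e)) 0≤N))))

  vertex-rounding : ∀ {e} U → 0ℚ < e → e < 1ℚ →
    Σ ℕ λ m → toℚ m * vertexDen e ≤ vertexNum e (toℚ U) × vertexNum e (toℚ U) < (1ℚ + toℚ m) * vertexDen e
  vertex-rounding {e} U 0<e e<1 = rounded (last-true P (λ k → toℚ k * vertexDen e ≤? vertexNum e (toℚ U)) (suc U) P0 ¬P[2+U])
    where
    P : ℕ → Set
    P k = toℚ k * vertexDen e ≤ vertexNum e (toℚ U)
    P0 : P 0
    P0 = subst (_≤ vertexNum e (toℚ U)) (sym (*-zeroˡ (vertexDen e))) (proj₁ (vertexNum-bounds U 0<e e<1))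
    ¬P[2+U] : ¬ P (suc (suc U))
    ¬P[2+U] ≤num = <-irrefl refl (<-≤-trans (proj₂ (vertexNum-bounds U 0<e e<1)) ≤num)
    rounded : Σ ℕ (λ r → P r × ¬ P (suc r)) →
      Σ ℕ λ m → toℚ m * vertexDen e ≤ vertexNum e (toℚ U) × vertexNum e (toℚ U) < (1ℚ + toℚ m) * vertexDen e
    rounded (m , m≤ , 1+m≰) = m , m≤ , subst (λ x → vertexNum e (toℚ U) < x * vertexDen e) (toℚ-+ 1 m) (≰⇒> 1+m≰)

  p+q≡0⇒p≯0 : ∀ {p q} → 0ℚ ≤ q → p + q ≡ 0ℚ → ¬ 0ℚ < p
  p+q≡0⇒p≯0 {p} {q} 0≤q p+q≡0 0<p = <-irrefl refl (<-≤-trans 0<p (subst (p ≤_) p+q≡0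
    (subst (_≤ p + q) (+-identityʳ p) (+-monoʳ-≤ p 0≤q))))

  gap-pos⇒1≤m : ∀ {e u} k → 0ℚ ≤ 1ℚ - e → 0ℚ ≤ u → 0ℚ < gap e u (toℚ k) → 1 ℕ.≤ k
  gap-pos⇒1≤m {e} {u} zero 0≤1-e 0≤u 0<gap = contradiction 0<gap (p+q≡0⇒p≯0 (0≤p*q 0≤1-e 0≤u)
    (solve 2 (λ e u → ((u :- con 0ℚ) :* con 0ℚ :- (con 1ℚ :- e) :* (u :+ con 0ℚ) :* (con 1ℚ :+ con 0ℚ)) :+ (con 1ℚ :- e) :* u
                      := con 0ℚ) refl e u))
  gap-pos⇒1≤m (suc k) _ _ _ = s≤s z≤n

  gap-pos⇒m≤U : ∀ {e} k U → 0ℚ ≤ 1ℚ - e → 0ℚ < gap e (toℚ U) (toℚ k) → k ℕ.≤ U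
  gap-pos⇒m≤U {e} k U 0≤1-e 0<gap with k ℕ.≤? U
  ... | yes k≤U = k≤U
  ... | no k≰U = contradiction 0<gap (p+q≡0⇒p≯0
    (0≤p+q (0≤p*q (p≤q⇒0≤q-p (toℚ-mono-≤ (ℕ.<⇒≤ (ℕ.≰⇒> k≰U)))) (0≤toℚ k))
           (0≤p*q (0≤p*q 0≤1-e (0≤p+q (0≤toℚ U) (0≤toℚ k))) (0≤p+q (0≤toℚ 1) (0≤toℚ k))))
    (solve 3 (λ e u k → ((u :- k) :* k :- (con 1ℚ :- e) :* (u :+ k) :* (con 1ℚ :+ k))
                        :+ ((k :- u) :* k :+ (con 1ℚ :- e) :* (u :+ k) :* (con 1ℚ :+ k)) := con 0ℚ) refl e (toℚ U) (toℚ k)))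


  gap⇒ratio : ∀ {ε} U m s → 0ℚ ≤ 1ℚ - ε → 0ℚ ≤ gap ε (toℚ U) (toℚ m) →
              2 ℕ.* (U ℕ.∸ s) ℕ.≤ U ℕ.+ m → U ℕ.≤ 2 ℕ.* s ℕ.+ m →
              (1ℚ - ε) * toℚ ((U ℕ.∸ s) ℕ.* suc m) ≤ toℚ (s ℕ.* m)
  gap⇒ratio {ε} U m s 0≤1-ε 0≤gap 2[U∸s]≤U+m U≤2s+m = *-cancelˡ-≤-pos (toℚ 2) (begin
    toℚ 2 * ((1ℚ - ε) * toℚ K)
      ≡⟨ solve 3 (λ t e k → t :* ((con 1ℚ :- e) :* k) := (con 1ℚ :- e) :* (t :* k)) refl (toℚ 2) ε (toℚ K) ⟩
    (1ℚ - ε) * (toℚ 2 * toℚ K)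
      ≡⟨ cong ((1ℚ - ε) *_) (toℚ-* 2 K) ⟨
    (1ℚ - ε) * toℚ (2 ℕ.* K)
      ≤⟨ *-monoˡ-≤-nonNeg (1ℚ - ε) {{nonNegative 0≤1-ε}} (toℚ-mono-≤ 2K≤[U+m][1+m]) ⟩
    (1ℚ - ε) * toℚ ((U ℕ.+ m) ℕ.* suc m)
      ≡⟨ cong ((1ℚ - ε) *_) (trans (toℚ-* (U ℕ.+ m) (suc m)) (cong₂ _*_ (toℚ-+ U m) (toℚ-+ 1 m))) ⟩
    (1ℚ - ε) * ((u + μ) * (1ℚ + μ))
      ≤⟨ 0≤q-p⇒p≤q (subst (0ℚ ≤_) (solve 3 (λ e u k →
           (u :- k) :* k :- (con 1ℚ :- e) :* (u :+ k) :* (con 1ℚ :+ k)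
           := (u :- k) :* k :- (con 1ℚ :- e) :* ((u :+ k) :* (con 1ℚ :+ k))) refl ε u μ) 0≤gap) ⟩
    (u - μ) * μ
      ≤⟨ *-monoʳ-≤-nonNeg μ {{nonNegative (0≤toℚ m)}} u-μ≤2s ⟩
    toℚ (2 ℕ.* s) * μ
      ≡⟨ toℚ-* (2 ℕ.* s) m ⟨
    toℚ (2 ℕ.* s ℕ.* m)
      ≡⟨ cong toℚ (ℕ.*-assoc 2 s m) ⟩
    toℚ (2 ℕ.* (s ℕ.* m))
      ≡⟨ toℚ-* 2 (s ℕ.* m) ⟩
    toℚ 2 * toℚ (s ℕ.* m)
      ∎)
    where
    open ≤-Reasoning
    u = toℚ U
    μ = toℚ m
    K = (U ℕ.∸ s) ℕ.* suc m
    2K≤[U+m][1+m] : 2 ℕ.* K ℕ.≤ (U ℕ.+ m) ℕ.* suc m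
    2K≤[U+m][1+m] = subst (ℕ._≤ (U ℕ.+ m) ℕ.* suc m) (ℕ.*-assoc 2 (U ℕ.∸ s) (suc m)) (ℕ.*-monoˡ-≤ (suc m) 2[U∸s]≤U+m)
    u-μ≤2s : u - μ ≤ toℚ (2 ℕ.* s)
    u-μ≤2s = 0≤q-p⇒p≤q (subst (0ℚ ≤_) (solve 3 (λ t u k → (t :+ k) :- u := t :- (u :- k)) refl (toℚ (2 ℕ.* s)) u μ)
               (p≤q⇒0≤q-p (subst (u ≤_) (toℚ-+ (2 ℕ.* s) m) (toℚ-mono-≤ U≤2s+m))))

  record Parameters (ε : ℚ) (U : ℕ) : Set where
    field
      s m : ℕ
      1≤m : 1 ℕ.≤ m
      2s+m≤1+U : 2 ℕ.* s ℕ.+ m ℕ.≤ suc U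
      0<[U∸s][1+m] : 0 ℕ.< (U ℕ.∸ s) ℕ.* suc m
      ratio : (1ℚ - ε) * toℚ ((U ℕ.∸ s) ℕ.* suc m) ≤ toℚ (s ℕ.* m)

  parameters : ∀ {ε} U → 0ℚ < ε → ε < 1ℚ → toℚ 8 < (1ℚ + toℚ U) * (ε * ε) → Parameters ε U
  parameters {ε} U 0<ε ε<1 8<Nε² = record
    { s = s
    ; m = m
    ; 1≤m = 1≤m
    ; 2s+m≤1+U = 2s+m≤1+U
    ; 0<[U∸s][1+m] = ℕ.≤-trans (ℕ.m<n⇒0<n∸m s<U) (ℕ.m≤m*n (U ℕ.∸ s) (suc m))
    ; ratio = gap⇒ratio {ε} U m s 0≤1-ε (<⇒≤ 0<gap) 2[U∸s]≤U+m U≤2s+m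
    }
    where
    0≤1-ε : 0ℚ ≤ 1ℚ - ε
    0≤1-ε = p≤q⇒0≤q-p (<⇒≤ ε<1)
    rounded = vertex-rounding U 0<ε ε<1
    m = proj₁ rounded
    0<gap : 0ℚ < gap ε (toℚ U) (toℚ m)
    0<gap = gap-pos 0<ε ε<1 (0≤toℚ U) 8<Nε² (proj₁ (proj₂ rounded)) (proj₂ (proj₂ rounded))
    1≤m = gap-pos⇒1≤m {ε} m 0≤1-ε (0≤toℚ U) 0<gap
    m≤U = gap-pos⇒m≤U {ε} m U 0≤1-ε 0<gap
    open Threshold U m 1≤m m≤U

  ratio-transfer : ∀ {r} {K L g h : ℕ} → 0 ℕ.< K → r * toℚ K ≤ toℚ L → L ℕ.* g ℕ.≤ h ℕ.* K → r * toℚ g ≤ toℚ h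
  ratio-transfer {r} {suc K} {L} {g} {h} _ rK≤L Lg≤hK = *-cancelʳ-≤-pos (toℚ (suc K)) {{positive (0<toℚ K)}} (begin
    r * toℚ g * toℚ (suc K)      ≡⟨ solve 3 (λ r g k → r :* g :* k := r :* k :* g) refl r (toℚ g) (toℚ (suc K)) ⟩
    r * toℚ (suc K) * toℚ g      ≤⟨ *-monoʳ-≤-nonNeg (toℚ g) {{nonNegative (0≤toℚ g)}} rK≤L ⟩
    toℚ L * toℚ g                ≡⟨ toℚ-* L g ⟨
    toℚ (L ℕ.* g)                ≤⟨ toℚ-mono-≤ Lg≤hK ⟩
    toℚ (h ℕ.* suc K)            ≡⟨ toℚ-* h (suc K) ⟩
    toℚ h * toℚ (suc K)          ∎)
    where open ≤-Reasoning

  sum≤floor : ∀ {β U} x y → toℚ x + toℚ y ≤ β → β < toℚ (suc U) → x ℕ.+ y ℕ.≤ U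
  sum≤floor x y x+y≤β β<1+U =
    ℕ.≤-pred (toℚ-cancel-< (≤-<-trans (subst (_≤ _) (sym (toℚ-+ x y)) x+y≤β) β<1+U))

  floor≤sum+1 : ∀ {β U} x y → β - 1ℚ ≤ toℚ x + toℚ y → toℚ U ≤ β → U ℕ.≤ x ℕ.+ y ℕ.+ 1
  floor≤sum+1 {β} {U} x y β-1≤x+y U≤β = toℚ-cancel-≤ (begin
    toℚ U                      ≤⟨ U≤β ⟩
    β                          ≡⟨ solve 1 (λ b → b := b :- con 1ℚ :+ con 1ℚ) refl β ⟩
    β - 1ℚ + 1ℚ                ≤⟨ +-monoˡ-≤ 1ℚ β-1≤x+y ⟩
    toℚ x + toℚ y + 1ℚ         ≡⟨ cong (_+ 1ℚ) (toℚ-+ x y) ⟨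
    toℚ (x ℕ.+ y) + 1ℚ         ≡⟨ toℚ-+ (x ℕ.+ y) 1 ⟨
    toℚ (x ℕ.+ y ℕ.+ 1)        ∎)
    where open ≤-Reasoning

  8<βε²⇒0≤β : ∀ {β ε} → 0ℚ < ε → toℚ 8 < β * (ε * ε) → 0ℚ ≤ β
  8<βε²⇒0≤β {β} {ε} 0<ε 8<βε² with 0ℚ ≤? β
  ... | yes 0≤β = 0≤β
  ... | no 0≰β = contradiction (<-≤-trans (<-trans (0<toℚ 7) 8<βε²) βε²≤0) (<-irrefl refl)
    where
    βε²≤0 : β * (ε * ε) ≤ 0ℚ
    βε²≤0 = subst (β * (ε * ε) ≤_) (*-zeroˡ (ε * ε))
      (*-monoʳ-≤-nonNeg (ε * ε) {{nonNegative (0≤p*q (<⇒≤ 0<ε) (<⇒≤ 0<ε))}} (<⇒≤ (≰⇒> 0≰β)))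

  8<βε²⇒8<[1+U]ε² : ∀ {β ε U} → 0ℚ < ε → toℚ 8 < β * (ε * ε) → β < toℚ (suc U) → toℚ 8 < (1ℚ + toℚ U) * (ε * ε)
  8<βε²⇒8<[1+U]ε² {β} {ε} {U} 0<ε 8<βε² β<1+U = <-≤-trans 8<βε² (subst (λ x → β * (ε * ε) ≤ x * (ε * ε)) (toℚ-+ 1 U)
    (*-monoʳ-≤-nonNeg (ε * ε) {{nonNegative (0≤p*q (<⇒≤ 0<ε) (<⇒≤ 0<ε))}} (<⇒≤ β<1+U)))

  1≤ε⇒bound : ∀ {ε} g h → 1ℚ ≤ ε → (1ℚ - ε) * toℚ g ≤ toℚ h
  1≤ε⇒bound {ε} g h 1≤ε = begin
    (1ℚ - ε) * toℚ g   ≤⟨ *-monoʳ-≤-nonNeg (toℚ g) {{nonNegative (0≤toℚ g)}} 1-ε≤0 ⟩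
    0ℚ * toℚ g         ≡⟨ *-zeroˡ (toℚ g) ⟩
    0ℚ                 ≤⟨ 0≤toℚ h ⟩
    toℚ h              ∎
    where
    open ≤-Reasoning
    1-ε≤0 : 1ℚ - ε ≤ 0ℚ
    1-ε≤0 = 0≤q-p⇒p≤q (subst (0ℚ ≤_) (solve 1 (λ e → e :- con 1ℚ := con 0ℚ :- (con 1ℚ :- e)) refl ε) (p≤q⇒0≤q-p 1≤ε))

open import Defs
open import Data.Nat using (ℕ)
open import Data.Integer using (+_)
open import Data.Rational using (ℚ; _/_; _≤_; _<_; _*_; _-_; 0ℚ; 1ℚ)

import Data.Nat as ℕ
import Data.Nat.Properties as ℕ
open import Data.Rational using (_≤?_)
open import Data.Rational.Properties using (≰⇒>)
open import Data.Product using (Σ; _×_; _,_)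
open import Relation.Nullary using (yes; no)
open Rationals
open IntegralBound using (integral-edcs-bound)

theorem5 : (ε β : ℚ) → 0ℚ < ε → (+ 8 / 1) < β * (ε * ε)
    → (G : Graph) → Bipartite G → (H : WeightedSubgraph G)
    → IsWeightedEDCS G H β (β - 1ℚ)
    → (μG μH : ℕ) → IsMaxMatchingSize (Adj G) μG → IsMaxMatchingSize (InH H) μH
    → (1ℚ - ε) * toℚ μG ≤ toℚ μH
theorem5 ε β 0<ε 8<βε² G bip H (H-edges , G-edges) μG μH maxG maxH with 1ℚ ≤? ε
... | yes 1≤ε = 1≤ε⇒bound μG μH 1≤ε
... | no 1≰ε = from-floor (ℕ-floor β (8<βε²⇒0≤β 0<ε 8<βε²))
  where
  from-floor : Σ ℕ (λ U → toℚ U ≤ β × β < toℚ (ℕ.suc U)) → (1ℚ - ε) * toℚ μG ≤ toℚ μH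
  from-floor (U , U≤β , β<1+U) = ratio-transfer {1ℚ - ε} {(U ℕ.∸ s) ℕ.* ℕ.suc m} {s ℕ.* m} {μG} {μH} 0<[U∸s][1+m] ratio
    (ℕ.≤-trans (ℕ.≤-reflexive (ℕ.*-assoc s m μG))
      (integral-edcs-bound G bip H U (λ a b ab → sum≤floor (degH H a) (degH H b) (H-edges a b ab) β<1+U)
                                     (λ a b adj → floor≤sum+1 (degH H a) (degH H b) (G-edges a b adj) U≤β)
                           s m 1≤m 2s+m≤1+U maxG maxH))
    where
    open Parameters (parameters U 0<ε (≰⇒> 1≰ε) (8<βε²⇒8<[1+U]ε² {U = U} 0<ε 8<βε² β<1+U))
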